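{- Let $q$ be a prime power. Pick positive integers $r$ and $n$ with $r\equiv n\pmod{q+1}$, and elements $a,b,v\in\mathbb{F}_{q^2}^*$ with $v\notin\mu_{q+1}$, and write \[ B(X) := a(X+v^{ -q})^n + b(X+v)^n \in \mathbb{F}_{q^2}[X]. \] Then the polynomial $f(X):=X^r B(X^{q-1})$ permutes $\mathbb{F}_{q^2}$ (i.e., the map $c\mapsto f(c)$ is a bijection $\mathbb{F}_{q^2}\to\mathbb{F}_{q^2}$) if and only if $bv^n/a\notin\mu_{q+1}$ and $\gcd(r,q-1)=1=\gcd(n,q+1)$.
   Context: $\mu_{q+1}$ denotes the set of $(q+1)$-th roots of unity in $\mathbb{F}_{q^2}^*$. -}

module Defs where

open import Level using (Level; _⊔_) renaming (suc to lsuc)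
open import Data.Nat using (ℕ; zero; suc; _^_; _≥_)
open import Data.Fin using (Fin)
open import Data.Product using (∃; ∃₂; _×_)
open import Data.Nat.Primality using (Prime)
open import Relation.Nullary using (¬_)
open import Relation.Binary.PropositionalEquality using (_≡_)
import Relation.Binary.PropositionalEquality as ≡
open import Algebra.Bundles using (CommutativeRing)
open import Function.Bundles using (Inverse)

IsPrimePower : ℕ → Set
IsPrimePower q = ∃₂ λ p k → Prime p × k ≥ 1 × q ≡ p ^ k

record Field c ℓ : Set (lsuc (c ⊔ ℓ)) where
  field
    commutativeRing : CommutativeRing c ℓ
  open CommutativeRing commutativeRing public
  field
    _⁻¹        : Carrier → Carrier
    0≉1        : ¬ (0# ≈ 1#)
    ⁻¹-inverse : ∀ x → ¬ (x ≈ 0#) → (x * (x ⁻¹)) ≈ 1#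

  pow : Carrier → ℕ → Carrier
  pow x zero    = 1#
  pow x (suc n) = x * pow x n

-- A field with exactly m elements (its element setoid is in bijection with Fin m).
-- Any such field with m = q ^ 2 is (isomorphic to) 𝔽_{q²}.
HasCardinality : ∀ {c ℓ} → Field c ℓ → ℕ → Set (c ⊔ ℓ)
HasCardinality F m = Inverse (Field.setoid F) (≡.setoid (Fin m))

{-# OPTIONS --safe #-}
-- Let s x = x + v^q x^q; it is 𝔽_q-linear and, since v^(q+1) ≠ 1, bijective. Multiplying the two linear
-- factors of B(x^(q-1)) by x turns them into multiples of s x, so x^n f(x) = x^r G(x) with G = s^n E,
-- E(x) = a v^(-qn) + b τ(x) and τ(x) = (s(x)^(q-1))^n ∈ μ_{q+1}. As r ≡ n (mod q+1), f(x)^(q-1) = G(x)^(q-1),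
-- and raising G to the q-th power shows that G(x)^(q-1) is a Möbius transform of τ(x) whose determinant
-- vanishes exactly when b v^n / a ∈ μ_{q+1}.
-- If the three conditions hold, f(x) = f(y) thus forces τ(x) = τ(y), then s(x)^(q-1) = s(y)^(q-1)
-- (gcd(n, q+1) = 1), i.e. x = λ y with λ ∈ 𝔽_q^*, and finally λ^r = 1 gives λ = 1 (gcd(r, q-1) = 1).
-- Conversely, let f be injective. A nontrivial common root of unity ζ of orders dividing r and q - 1 would
-- give f ζ = f 1. Once gcd(r, q-1) = 1, every c ≠ 0 with f(c)^(q-1) = f(1)^(q-1) lies in 𝔽_q, and each of
-- the two other failing conditions produces such a c outside 𝔽_q.
module Submission where

open import Defs
open import Data.Nat as ℕ using (ℕ; zero; suc; _∸_; _%_; _/_; _^_; _≤_; _<_; _≥_; s≤s; z≤n)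
import Data.Nat.Properties as ℕP
open import Data.Nat.GCD using (gcd; gcd[m,n]∣m; gcd[m,n]∣n; gcd[m,n]≢0; gcd-GCD; module Bézout)
open import Data.Nat.Divisibility using (_∣_; divides)
open import Data.Product using (_×_; _,_; ∃; proj₁; proj₂)
open import Data.Sum using (inj₁; inj₂)
open import Data.Empty using (⊥; ⊥-elim)
import Data.Integer as ℤ
open import Data.Fin as Fin using (Fin; zero; suc)
import Data.Fin.Properties as FinP
open import Relation.Nullary using (¬_; Dec; yes; no)
open import Relation.Binary.PropositionalEquality as ≡ using (_≡_; _≢_)
open import Function.Definitions using (Bijective; Injective; Surjective; Congruent)
open import Function.Bundles using (_⇔_; mk⇔; Inverse)
open import Algebra.Bundles using (CommutativeRing; RawRing)

module IntegerCoefficientSolver {c ℓ} (R : CommutativeRing c ℓ) where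
  open CommutativeRing R
  open import Data.Integer as ℤ using (ℤ; +_; -[1+_]; _⊖_; sign; ∣_∣; _◃_)
  import Data.Integer.Properties as ℤP
  open import Data.Sign as Sign using (Sign)
  open import Data.Maybe using (Maybe; just; nothing)
  open import Algebra.Properties.Ring ring using (-‿distribˡ-*; -‿involutive; -0#≈0#)
  open import Algebra.Properties.AbelianGroup +-abelianGroup using (⁻¹-∙-comm)
  open import Algebra.Properties.CommutativeSemigroup +-commutativeSemigroup using (interchange)
  open import Algebra.Properties.CommutativeSemigroup *-commutativeSemigroup
    using () renaming (interchange to *-interchange)
  open import Algebra.Properties.Semiring.Mult semiring using (×-homo-+; ×-homo-0; ×-homo-1; ×1-homo-*)
    renaming (_×_ to _×ₘ_)
  open import Algebra.Solver.Ring.AlmostCommutativeRing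
  open import Relation.Binary.Reasoning.Setoid setoid

  ⟦_⟧ℤ : ℤ → Carrier
  ⟦ + n ⟧ℤ    = n ×ₘ 1#
  ⟦ -[1+ n ] ⟧ℤ = - (suc n ×ₘ 1#)

  ⟦_⟧ₛ : Sign → Carrier
  ⟦ Sign.+ ⟧ₛ = 1#
  ⟦ Sign.- ⟧ₛ = - 1#

  private
    suc×1 : ∀ n → suc n ×ₘ 1# ≈ 1# + n ×ₘ 1#
    suc×1 n = trans (×-homo-+ 1# 1 n) (+-congʳ (×-homo-1 1#))

    [1+x]-[1+y] : ∀ x y → (1# + x) - (1# + y) ≈ x - y
    [1+x]-[1+y] x y = begin
      (1# + x) + - (1# + y)   ≈⟨ +-congˡ (sym (⁻¹-∙-comm 1# y)) ⟩
      (1# + x) + (- 1# + - y) ≈⟨ interchange 1# x (- 1#) (- y) ⟩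
      (1# + - 1#) + (x - y)   ≈⟨ +-congʳ (-‿inverseʳ 1#) ⟩
      0# + (x - y)            ≈⟨ +-identityˡ _ ⟩
      x - y                   ∎

  ⟦⊖⟧ : ∀ m n → ⟦ m ⊖ n ⟧ℤ ≈ m ×ₘ 1# - n ×ₘ 1#
  ⟦⊖⟧ zero    zero    = sym (trans (+-congˡ -0#≈0#) (+-identityʳ _))
  ⟦⊖⟧ zero    (suc n) = sym (+-identityˡ _)
  ⟦⊖⟧ (suc m) zero    = sym (trans (+-congˡ -0#≈0#) (+-identityʳ _))
  ⟦⊖⟧ (suc m) (suc n) = begin
    ⟦ suc m ⊖ suc n ⟧ℤ              ≡⟨ ≡.cong ⟦_⟧ℤ (ℤP.[1+m]⊖[1+n]≡m⊖n m n) ⟩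
    ⟦ m ⊖ n ⟧ℤ                      ≈⟨ ⟦⊖⟧ m n ⟩
    m ×ₘ 1# - n ×ₘ 1#                 ≈⟨ [1+x]-[1+y] _ _ ⟨
    (1# + m ×ₘ 1#) - (1# + n ×ₘ 1#)   ≈⟨ +-cong (suc×1 m) (-‿cong (suc×1 n)) ⟨
    suc m ×ₘ 1# - suc n ×ₘ 1#         ∎

  ⟦+⟧ : ∀ i j → ⟦ i ℤ.+ j ⟧ℤ ≈ ⟦ i ⟧ℤ + ⟦ j ⟧ℤ
  ⟦+⟧ (+ m)    (+ n)    = ×-homo-+ 1# m n
  ⟦+⟧ (+ m)    -[1+ n ] = ⟦⊖⟧ m (suc n)
  ⟦+⟧ -[1+ m ] (+ n)    = trans (⟦⊖⟧ n (suc m)) (+-comm _ _)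
  ⟦+⟧ -[1+ m ] -[1+ n ] = begin
    - (suc (suc (m ℕ.+ n)) ×ₘ 1#)      ≡⟨ ≡.cong (λ k → - (k ×ₘ 1#)) (≡.sym (ℕP.+-suc (suc m) n)) ⟩
    - ((suc m ℕ.+ suc n) ×ₘ 1#)        ≈⟨ -‿cong (×-homo-+ 1# (suc m) (suc n)) ⟩
    - (suc m ×ₘ 1# + suc n ×ₘ 1#)       ≈⟨ ⁻¹-∙-comm _ _ ⟨
    - (suc m ×ₘ 1#) + - (suc n ×ₘ 1#)   ∎

  ⟦-⟧ : ∀ i → ⟦ ℤ.- i ⟧ℤ ≈ - ⟦ i ⟧ℤ
  ⟦-⟧ (+ zero)  = sym -0#≈0#
  ⟦-⟧ (+ suc n) = refl
  ⟦-⟧ -[1+ n ]  = sym (-‿involutive _)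

  ⟦◃⟧ : ∀ s n → ⟦ s ◃ n ⟧ℤ ≈ ⟦ s ⟧ₛ * (n ×ₘ 1#)
  ⟦◃⟧ Sign.+ zero    = sym (*-identityˡ _)
  ⟦◃⟧ Sign.- zero    = sym (trans (*-congˡ (×-homo-0 1#)) (zeroʳ _))
  ⟦◃⟧ Sign.+ (suc n) = sym (*-identityˡ _)
  ⟦◃⟧ Sign.- (suc n) = trans (-‿cong (sym (*-identityˡ _))) (-‿distribˡ-* _ _)

  ⟦*⟧ₛ : ∀ s t → ⟦ s Sign.* t ⟧ₛ ≈ ⟦ s ⟧ₛ * ⟦ t ⟧ₛ
  ⟦*⟧ₛ Sign.+ t      = sym (*-identityˡ _)
  ⟦*⟧ₛ Sign.- Sign.+ = sym (*-identityʳ _)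
  ⟦*⟧ₛ Sign.- Sign.- = sym (trans (sym (-‿distribˡ-* _ _)) (trans (-‿cong (*-identityˡ _)) (-‿involutive _)))

  ⟦sign◃∣∣⟧ : ∀ i → ⟦ i ⟧ℤ ≈ ⟦ sign i ⟧ₛ * (∣ i ∣ ×ₘ 1#)
  ⟦sign◃∣∣⟧ i = trans (reflexive (≡.cong ⟦_⟧ℤ (≡.sym (ℤP.◃-inverse i)))) (⟦◃⟧ (sign i) ∣ i ∣)

  ⟦*⟧ : ∀ i j → ⟦ i ℤ.* j ⟧ℤ ≈ ⟦ i ⟧ℤ * ⟦ j ⟧ℤ
  ⟦*⟧ i j = begin
    ⟦ (sign i Sign.* sign j) ◃ (∣ i ∣ ℕ.* ∣ j ∣) ⟧ℤ
      ≈⟨ ⟦◃⟧ (sign i Sign.* sign j) (∣ i ∣ ℕ.* ∣ j ∣) ⟩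
    ⟦ sign i Sign.* sign j ⟧ₛ * ((∣ i ∣ ℕ.* ∣ j ∣) ×ₘ 1#)
      ≈⟨ *-cong (⟦*⟧ₛ (sign i) (sign j)) (×1-homo-* ∣ i ∣ ∣ j ∣) ⟩
    (⟦ sign i ⟧ₛ * ⟦ sign j ⟧ₛ) * ((∣ i ∣ ×ₘ 1#) * (∣ j ∣ ×ₘ 1#))
      ≈⟨ *-interchange _ _ _ _ ⟩
    (⟦ sign i ⟧ₛ * (∣ i ∣ ×ₘ 1#)) * (⟦ sign j ⟧ₛ * (∣ j ∣ ×ₘ 1#))
      ≈⟨ *-cong (⟦sign◃∣∣⟧ i) (⟦sign◃∣∣⟧ j) ⟨
    ⟦ i ⟧ℤ * ⟦ j ⟧ℤ ∎

  ℤ-rawRing : RawRing _ _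
  ℤ-rawRing = record
    { Carrier = ℤ ; _≈_ = _≡_ ; _+_ = ℤ._+_ ; _*_ = ℤ._*_ ; -_ = ℤ.-_ ; 0# = + 0 ; 1# = + 1 }

  ⟦_⟧ℤ-morphism : ℤ-rawRing -Raw-AlmostCommutative⟶ fromCommutativeRing R
  ⟦_⟧ℤ-morphism = record
    { ⟦_⟧ = ⟦_⟧ℤ ; +-homo = ⟦+⟧ ; *-homo = ⟦*⟧ ; -‿homo = ⟦-⟧ ; 0-homo = refl ; 1-homo = ×-homo-1 1# }

  ≟-coefficients : ∀ i j → Maybe (⟦ i ⟧ℤ ≈ ⟦ j ⟧ℤ)
  ≟-coefficients i j with i ℤ.≟ j
  ... | yes ≡.refl = just refl
  ... | no _       = nothing

  open import Algebra.Solver.Ring ℤ-rawRing (fromCommutativeRing R) ⟦_⟧ℤ-morphism ≟-coefficients public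

module FieldProperties {c ℓ} (F : Field c ℓ) where
  open Field F public hiding (zero)
  open IntegerCoefficientSolver commutativeRing public
  open import Relation.Binary.Reasoning.Setoid setoid public

  1#≉0# : 1# ≉ 0#
  1#≉0# e = 0≉1 (sym e)

  pow-cong : ∀ {x y} n → x ≈ y → pow x n ≈ pow y n
  pow-cong zero    e = refl
  pow-cong (suc n) e = *-cong e (pow-cong n e)

  pow-+ : ∀ x m n → pow x (m ℕ.+ n) ≈ pow x m * pow x n
  pow-+ x zero    n = sym (*-identityˡ _)
  pow-+ x (suc m) n = trans (*-congˡ (pow-+ x m n)) (sym (*-assoc _ _ _))

  pow-distrib-* : ∀ x y n → pow (x * y) n ≈ pow x n * pow y n
  pow-distrib-* x y zero    = sym (*-identityˡ _)
  pow-distrib-* x y (suc n) = trans (*-congˡ (pow-distrib-* x y n))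
    (solve 4 (λ x y a b → (x :* y) :* (a :* b) := (x :* a) :* (y :* b)) refl x y _ _)

  pow-1# : ∀ n → pow 1# n ≈ 1#
  pow-1# zero    = refl
  pow-1# (suc n) = trans (*-identityˡ _) (pow-1# n)

  pow-0# : ∀ n → n ≢ 0 → pow 0# n ≈ 0#
  pow-0# zero    n≢0 = ⊥-elim (n≢0 ≡.refl)
  pow-0# (suc n) _   = zeroˡ _

  pow-* : ∀ x m n → pow x (m ℕ.* n) ≈ pow (pow x m) n
  pow-* x zero    n = sym (pow-1# n)
  pow-* x (suc m) n = begin
    pow x (n ℕ.+ m ℕ.* n)      ≈⟨ pow-+ x n (m ℕ.* n) ⟩
    pow x n * pow x (m ℕ.* n)  ≈⟨ *-congˡ (pow-* x m n) ⟩
    pow x n * pow (pow x m) n  ≈⟨ pow-distrib-* x (pow x m) n ⟨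
    pow (x * pow x m) n        ∎

  pow-*ʳ : ∀ x m n → pow x (m ℕ.* n) ≈ pow (pow x n) m
  pow-*ʳ x m n = trans (reflexive (≡.cong (pow x) (ℕP.*-comm m n))) (pow-* x n m)

  pow-pow-comm : ∀ x m n → pow (pow x m) n ≈ pow (pow x n) m
  pow-pow-comm x m n = trans (sym (pow-* x m n)) (pow-*ʳ x m n)

  pow-multiple≈1 : ∀ {x} m n → pow x m ≈ 1# → pow x (n ℕ.* m) ≈ 1#
  pow-multiple≈1 {x} m n e = trans (pow-*ʳ x n m) (trans (pow-cong n e) (pow-1# n))

  pow-∣≈1 : ∀ {x d k} → pow x d ≈ 1# → d ∣ k → pow x k ≈ 1#
  pow-∣≈1 {x} {d} xᵈ≈1 (divides t k≡td) =
    trans (reflexive (≡.cong (pow x) k≡td)) (pow-multiple≈1 d t xᵈ≈1)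

  pow-mod : ∀ {x} m .{{_ : ℕ.NonZero m}} i j → i % m ≡ j % m → pow x m ≈ 1# → pow x i ≈ pow x j
  pow-mod {x} m i j i≡j e = trans (reduce i) (trans (reflexive (≡.cong (pow x) i≡j)) (sym (reduce j)))
    where
    open import Data.Nat.DivMod using (m≡m%n+[m/n]*n)
    reduce : ∀ k → pow x k ≈ pow x (k % m)
    reduce k = begin
      pow x k                                   ≡⟨ ≡.cong (pow x) (m≡m%n+[m/n]*n k m) ⟩
      pow x (k % m ℕ.+ (k / m) ℕ.* m)           ≈⟨ pow-+ x (k % m) ((k / m) ℕ.* m) ⟩
      pow x (k % m) * pow x ((k / m) ℕ.* m)     ≈⟨ *-congˡ (pow-multiple≈1 m (k / m) e) ⟩
      pow x (k % m) * 1#                        ≈⟨ *-identityʳ _ ⟩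
      pow x (k % m)                             ∎

  ⁻¹-inverseˡ : ∀ x → x ≉ 0# → x ⁻¹ * x ≈ 1#
  ⁻¹-inverseˡ x x≉0 = trans (*-comm _ _) (⁻¹-inverse x x≉0)

  *-cancelˡ : ∀ {x y z} → x ≉ 0# → x * y ≈ x * z → y ≈ z
  *-cancelˡ {x} {y} {z} x≉0 e = begin
    y                ≈⟨ *-identityˡ y ⟨
    1# * y           ≈⟨ *-congʳ (⁻¹-inverseˡ x x≉0) ⟨
    (x ⁻¹ * x) * y   ≈⟨ *-assoc _ _ _ ⟩
    x ⁻¹ * (x * y)   ≈⟨ *-congˡ e ⟩
    x ⁻¹ * (x * z)   ≈⟨ *-assoc _ _ _ ⟨
    (x ⁻¹ * x) * z   ≈⟨ *-congʳ (⁻¹-inverseˡ x x≉0) ⟩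
    1# * z           ≈⟨ *-identityˡ z ⟩
    z                ∎

  *-cancelʳ : ∀ {x y z} → x ≉ 0# → y * x ≈ z * x → y ≈ z
  *-cancelʳ x≉0 e = *-cancelˡ x≉0 (trans (*-comm _ _) (trans e (*-comm _ _)))

  zero-product : ∀ {x y} → x * y ≈ 0# → x ≉ 0# → y ≈ 0#
  zero-product x*y≈0 x≉0 = *-cancelˡ x≉0 (trans x*y≈0 (sym (zeroʳ _)))

  *-nonZero : ∀ {x y} → x ≉ 0# → y ≉ 0# → x * y ≉ 0#
  *-nonZero x≉0 y≉0 e = y≉0 (zero-product e x≉0)

  pow-nonZero : ∀ {x} n → x ≉ 0# → pow x n ≉ 0#
  pow-nonZero zero    x≉0 = 1#≉0#
  pow-nonZero (suc n) x≉0 = *-nonZero x≉0 (pow-nonZero n x≉0)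

  ⁻¹-nonZero : ∀ {x} → x ≉ 0# → x ⁻¹ ≉ 0#
  ⁻¹-nonZero {x} x≉0 e = 0≉1 (trans (sym (zeroʳ x)) (trans (*-congˡ (sym e)) (⁻¹-inverse x x≉0)))

  ⁻¹-unique : ∀ {x y} → x ≉ 0# → x * y ≈ 1# → y ≈ x ⁻¹
  ⁻¹-unique {x} x≉0 e = *-cancelˡ x≉0 (trans e (sym (⁻¹-inverse x x≉0)))

  ⁻¹-cong : ∀ {x y} → x ≉ 0# → x ≈ y → x ⁻¹ ≈ y ⁻¹
  ⁻¹-cong {x} x≉0 e = ⁻¹-unique (λ y≈0 → x≉0 (trans e y≈0)) (trans (*-congʳ (sym e)) (⁻¹-inverse x x≉0))

  pow-*≈1 : ∀ {x y} m → x * y ≈ 1# → pow x m * pow y m ≈ 1#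
  pow-*≈1 {x} {y} m xy≈1 = trans (sym (pow-distrib-* x y m)) (trans (pow-cong m xy≈1) (pow-1# m))

  pow-⁻¹ : ∀ x m → x ≉ 0# → pow (x ⁻¹) m ≈ (pow x m) ⁻¹
  pow-⁻¹ x m x≉0 = ⁻¹-unique (pow-nonZero m x≉0) (pow-*≈1 m (⁻¹-inverse x x≉0))

  x-y≈0⇒x≈y : ∀ {x y} → x - y ≈ 0# → x ≈ y
  x-y≈0⇒x≈y {x} {y} e = begin
    x           ≈⟨ solve 2 (λ x y → x := (x :- y) :+ y) refl x y ⟩
    (x - y) + y ≈⟨ +-congʳ e ⟩
    0# + y      ≈⟨ +-identityˡ y ⟩
    y           ∎

  [1-u]*x≈x-u*x : ∀ u x → (1# - u) * x ≈ x - u * x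
  [1-u]*x≈x-u*x u x = trans (solve 3 (λ o u x → (o :- u) :* x := o :* x :- u :* x) refl 1# u x) (+-congʳ (*-identityˡ x))

  x≈y⇒x-y≈0 : ∀ {x y} → x ≈ y → x - y ≈ 0#
  x≈y⇒x-y≈0 {y = y} e = trans (+-congʳ e) (-‿inverseʳ y)

  private
    coprime-identity : ∀ m n → gcd m n ≡ 1 → Bézout.Identity 1 m n
    coprime-identity m n g = ≡.subst (λ d → Bézout.Identity d m n) g
      (Bézout.identity (gcd-GCD m n))

    ≈-from-bezout : ∀ {x y} m n i j → 1 ℕ.+ j ℕ.* n ≡ i ℕ.* m → y ≉ 0# →
                    pow x m ≈ pow y m → pow x n ≈ pow y n → x ≈ y
    ≈-from-bezout {x} {y} m n i j eq y≉0 xᵐ≈yᵐ xⁿ≈yⁿ = *-cancelʳ (pow-nonZero j (pow-nonZero n y≉0)) (begin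
      x * pow (pow y n) j   ≈⟨ *-congˡ (pow-cong j xⁿ≈yⁿ) ⟨
      x * pow (pow x n) j   ≈⟨ *-congˡ (pow-*ʳ x j n) ⟨
      pow x (1 ℕ.+ j ℕ.* n) ≡⟨ ≡.cong (pow x) eq ⟩
      pow x (i ℕ.* m)       ≈⟨ pow-*ʳ x i m ⟩
      pow (pow x m) i       ≈⟨ pow-cong i xᵐ≈yᵐ ⟩
      pow (pow y m) i       ≈⟨ pow-*ʳ y i m ⟨
      pow y (i ℕ.* m)       ≡⟨ ≡.cong (pow y) eq ⟨
      pow y (1 ℕ.+ j ℕ.* n) ≈⟨ *-congˡ (pow-*ʳ y j n) ⟩
      y * pow (pow y n) j   ∎)

  pow-injective-coprime : ∀ {x y} m n → gcd m n ≡ 1 → y ≉ 0# →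
                          pow x m ≈ pow y m → pow x n ≈ pow y n → x ≈ y
  pow-injective-coprime m n g y≉0 xᵐ≈yᵐ xⁿ≈yⁿ with coprime-identity m n g
  ... | Bézout.+- i j eq = ≈-from-bezout m n i j eq y≉0 xᵐ≈yᵐ xⁿ≈yⁿ
  ... | Bézout.-+ i j eq = ≈-from-bezout n m j i eq y≉0 xⁿ≈yⁿ xᵐ≈yᵐ

  ∃-root-coprime : ∀ r m {x} → gcd r m ≡ 1 → pow x m ≈ 1# → ∃ λ μ → pow μ m ≈ 1# × pow μ r ≈ x
  ∃-root-coprime r m {x} g xᵐ≈1 with coprime-identity r m g
  ... | Bézout.+- i j eq = pow x i , root-of-unity , (begin
    pow (pow x i) r         ≈⟨ pow-*ʳ x r i ⟨
    pow x (r ℕ.* i)         ≡⟨ ≡.cong (pow x) (≡.trans (ℕP.*-comm r i) (≡.sym eq)) ⟩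
    x * pow x (j ℕ.* m)     ≈⟨ *-congˡ (pow-multiple≈1 m j xᵐ≈1) ⟩
    x * 1#                  ≈⟨ *-identityʳ x ⟩
    x                       ∎)
    where
    root-of-unity : pow (pow x i) m ≈ 1#
    root-of-unity = trans (pow-pow-comm x i m) (trans (pow-cong i xᵐ≈1) (pow-1# i))
  ... | Bézout.-+ i j eq = (pow x i) ⁻¹ , root-of-unity , μʳ≈x
    where
    x*[xⁱ]ʳ≈1 : x * pow (pow x i) r ≈ 1#
    x*[xⁱ]ʳ≈1 = begin
      x * pow (pow x i) r     ≈⟨ *-congˡ (pow-*ʳ x r i) ⟨
      pow x (1 ℕ.+ r ℕ.* i)   ≡⟨ ≡.cong (λ k → pow x (1 ℕ.+ k)) (ℕP.*-comm r i) ⟩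
      pow x (1 ℕ.+ i ℕ.* r)   ≡⟨ ≡.cong (pow x) eq ⟩
      pow x (j ℕ.* m)         ≈⟨ pow-multiple≈1 m j xᵐ≈1 ⟩
      1#                      ∎
    xⁱ≉0 : pow x i ≉ 0#
    xⁱ≉0 = pow-nonZero i λ x≈0 → 0≉1 (trans (sym (zeroˡ _)) (trans (*-congʳ (sym x≈0)) x*[xⁱ]ʳ≈1))
    root-of-unity : pow ((pow x i) ⁻¹) m ≈ 1#
    root-of-unity = begin
      pow ((pow x i) ⁻¹) m  ≈⟨ pow-⁻¹ (pow x i) m xⁱ≉0 ⟩
      (pow (pow x i) m) ⁻¹  ≈⟨ ⁻¹-cong (pow-nonZero m xⁱ≉0) (trans (pow-pow-comm x i m) (trans (pow-cong i xᵐ≈1) (pow-1# i))) ⟩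
      1# ⁻¹                 ≈⟨ ⁻¹-unique 1#≉0# (*-identityˡ 1#) ⟨
      1#                    ∎
    μʳ≈x : pow ((pow x i) ⁻¹) r ≈ x
    μʳ≈x = trans (pow-⁻¹ (pow x i) r xⁱ≉0) (sym (⁻¹-unique (pow-nonZero r xⁱ≉0) (trans (*-comm _ _) x*[xⁱ]ʳ≈1)))

module _ where
  open import Data.Nat.Divisibility using (∣⇒≤; m∣m*n)
  open import Data.Nat.Combinatorics using (_C_; nCk≡n!/k![n-k]!; k![n∸k]!∣n!)
  open import Data.Nat.DivMod using (m/n*n≡m)
  open import Data.Nat.Primality using (Prime; euclidsLemma; prime⇒nonTrivial)
  open import Data.Nat.Base using (_!; nonTrivial⇒n>1)
  open ℕP using (_!*_!≢0)

  prime>1 : ∀ {p} → Prime p → 1 < p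
  prime>1 {p} pp = nonTrivial⇒n>1 p {{prime⇒nonTrivial pp}}

  prime∤! : ∀ {p} → Prime p → ∀ j → j < p → ¬ (p ∣ j !)
  prime∤! pp zero    j<p p∣1 = ℕP.<-irrefl ≡.refl (ℕP.≤-trans (prime>1 pp) (∣⇒≤ p∣1))
  prime∤! pp (suc j) j<p p∣j! with euclidsLemma (suc j) (j !) pp p∣j!
  ... | inj₁ p∣1+j = ℕP.<-irrefl ≡.refl (ℕP.<-≤-trans j<p (∣⇒≤ p∣1+j))
  ... | inj₂ p∣j!  = prime∤! pp j (ℕP.<-trans (ℕP.n<1+n j) j<p) p∣j!

  prime∣C : ∀ {p j} → Prime p → 0 < j → j < p → p ∣ p C j
  prime∣C {p} {j} pp 0<j j<p
    with euclidsLemma (p C j) (j ! ℕ.* (p ∸ j) !) pp (≡.subst (p ∣_) (≡.sym p!≡) (n∣n! p (ℕP.<-trans (s≤s z≤n) (prime>1 pp))))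
    where
    instance _ = j !* (p ∸ j) !≢0
    p!≡ : (p C j) ℕ.* (j ! ℕ.* (p ∸ j) !) ≡ p !
    p!≡ = ≡.trans (≡.cong (ℕ._* (j ! ℕ.* (p ∸ j) !)) (nCk≡n!/k![n-k]! (ℕP.<⇒≤ j<p)))
                  (m/n*n≡m (k![n∸k]!∣n! (ℕP.<⇒≤ j<p)))
    n∣n! : ∀ n → 0 < n → n ∣ n !
    n∣n! (suc n) _ = m∣m*n (n !)
  ... | inj₁ p∣C = p∣C
  ... | inj₂ p∣j![p-j]! with euclidsLemma (j !) ((p ∸ j) !) pp p∣j![p-j]!
  ...   | inj₁ p∣j!     = ⊥-elim (prime∤! pp j j<p p∣j!)
  ...   | inj₂ p∣[p-j]! = ⊥-elim (prime∤! pp (p ∸ j) (ℕP.∸-monoʳ-< 0<j (ℕP.<⇒≤ j<p)) p∣[p-j]!)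

module Frobenius {c ℓ} (F : Field c ℓ) where
  open FieldProperties F
  open import Data.Nat.Primality using (Prime)
  open import Data.Nat.Combinatorics using (_C_; nCn≡1)
  open import Data.Fin using (toℕ; inject₁; fromℕ)
  open import Algebra.Properties.Semiring.Mult semiring using (×-assoc-*; ×-congʳ; ×-congˡ; ×-homo-1; ×1-homo-*)
    renaming (_×_ to _×ₘ_)
  open import Algebra.Properties.Semiring.Exp semiring using () renaming (_^_ to _^ₑ_)
  open import Algebra.Properties.Semiring.Sum semiring using (sum; sum-cong-≋; sum-replicate-zero; sum-init-last)
  open import Algebra.Properties.CommutativeSemiring.Binomial commutativeSemiring
    using (binomialExpansion; binomialTerm) renaming (theorem to binomial-theorem)

  ^ₑ≈pow : ∀ x n → x ^ₑ n ≈ pow x n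
  ^ₑ≈pow x zero    = refl
  ^ₑ≈pow x (suc n) = *-congˡ (^ₑ≈pow x n)

  ×ₘ-multiple-of-char : ∀ {p} → p ×ₘ 1# ≈ 0# → ∀ t z → (t ℕ.* p) ×ₘ z ≈ 0#
  ×ₘ-multiple-of-char {p} char-p t z = begin
    (t ℕ.* p) ×ₘ z                    ≈⟨ ×-congʳ (t ℕ.* p) (*-identityˡ z) ⟨
    (t ℕ.* p) ×ₘ (1# * z)             ≈⟨ ×-assoc-* (t ℕ.* p) 1# z ⟨
    ((t ℕ.* p) ×ₘ 1#) * z             ≈⟨ *-congʳ (×1-homo-* t p) ⟩
    ((t ×ₘ 1#) * (p ×ₘ 1#)) * z       ≈⟨ *-congʳ (*-congˡ char-p) ⟩
    ((t ×ₘ 1#) * 0#) * z              ≈⟨ *-congʳ (zeroʳ _) ⟩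
    0# * z                            ≈⟨ zeroˡ z ⟩
    0#                                ∎

  binomialTerm-vanishes : ∀ {p} → Prime p → p ×ₘ 1# ≈ 0# →
                          ∀ x y (j : Fin (suc p)) → 0 < toℕ j → toℕ j < p → binomialTerm x y p j ≈ 0#
  binomialTerm-vanishes pp char-p x y j 0<j j<p with prime∣C pp 0<j j<p
  ... | divides t eq = trans (×-congˡ eq) (×ₘ-multiple-of-char char-p t _)

  pow-prime-+ : ∀ {p} → Prime p → p ×ₘ 1# ≈ 0# → ∀ x y → pow (x + y) p ≈ pow x p + pow y p
  pow-prime-+ {suc m} pp char-p x y = begin
    pow (x + y) (suc m)                             ≈⟨ ^ₑ≈pow (x + y) (suc m) ⟨
    (x + y) ^ₑ suc m                                ≈⟨ binomial-theorem (suc m) x y ⟩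
    binomialExpansion x y (suc m)                   ≈⟨ +-congˡ (sum-init-last (λ i → t (suc i))) ⟩
    t zero + (sum (λ i → t (suc (inject₁ i))) + t (suc (fromℕ m)))
      ≈⟨ +-congˡ (+-congʳ (trans (sum-cong-≋ middle-vanishes) (sum-replicate-zero m))) ⟩
    t zero + (0# + t (suc (fromℕ m)))               ≈⟨ +-cong first (trans (+-identityˡ _) last) ⟩
    pow y (suc m) + pow x (suc m)                   ≈⟨ +-comm _ _ ⟩
    pow x (suc m) + pow y (suc m)                   ∎
    where
    t : Fin (suc (suc m)) → Carrier
    t = binomialTerm x y (suc m)
    middle-vanishes : ∀ i → t (suc (inject₁ i)) ≈ 0#
    middle-vanishes i = binomialTerm-vanishes pp char-p x y (suc (inject₁ i)) (s≤s z≤n)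
      (s≤s (≡.subst (_< m) (≡.sym (FinP.toℕ-inject₁ i)) (FinP.toℕ<n i)))
    first : t zero ≈ pow y (suc m)
    first = trans (×-homo-1 _) (trans (*-identityˡ _) (^ₑ≈pow y (suc m)))
    last : t (suc (fromℕ m)) ≈ pow x (suc m)
    last = begin
      t (suc (fromℕ m))                                   ≡⟨ ≡.cong (λ k → (suc m C k) ×ₘ ((x ^ₑ k) * (y ^ₑ (suc m ∸ k))))
                                                                    (≡.cong suc (FinP.toℕ-fromℕ m)) ⟩
      (suc m C suc m) ×ₘ ((x ^ₑ suc m) * (y ^ₑ (m ∸ m)))   ≡⟨ ≡.cong₂ (λ k l → k ×ₘ ((x ^ₑ suc m) * (y ^ₑ l))) (nCn≡1 (suc m)) (ℕP.n∸n≡0 m) ⟩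
      1 ×ₘ ((x ^ₑ suc m) * 1#)                            ≈⟨ trans (×-homo-1 _) (*-identityʳ _) ⟩
      x ^ₑ suc m                                          ≈⟨ ^ₑ≈pow x (suc m) ⟩
      pow x (suc m)                                       ∎

  pow-prime^-+ : ∀ {p} → Prime p → p ×ₘ 1# ≈ 0# → ∀ k x y → pow (x + y) (p ℕ.^ k) ≈ pow x (p ℕ.^ k) + pow y (p ℕ.^ k)
  pow-prime^-+ pp char-p zero x y = trans (*-identityʳ _) (sym (+-cong (*-identityʳ x) (*-identityʳ y)))
  pow-prime^-+ {p} pp char-p (suc k) x y = begin
    pow (x + y) (p ℕ.* p ℕ.^ k)                       ≈⟨ pow-* (x + y) p (p ℕ.^ k) ⟩
    pow (pow (x + y) p) (p ℕ.^ k)                     ≈⟨ pow-cong (p ℕ.^ k) (pow-prime-+ pp char-p x y) ⟩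
    pow (pow x p + pow y p) (p ℕ.^ k)                 ≈⟨ pow-prime^-+ pp char-p k _ _ ⟩
    pow (pow x p) (p ℕ.^ k) + pow (pow y p) (p ℕ.^ k) ≈⟨ +-cong (pow-* x p _) (pow-* y p _) ⟨
    pow x (p ℕ.* p ℕ.^ k) + pow y (p ℕ.* p ℕ.^ k)     ∎

module Polynomials {c ℓ} (F : Field c ℓ) where
  open FieldProperties F
  open import Data.Vec using (Vec; []; _∷_; map)

  -- Coefficient vectors, constant term first; the last entry is the leading coefficient.
  eval : ∀ {n} → Vec Carrier n → Carrier → Carrier
  eval []       x = 0#
  eval (c ∷ cs) x = c + x * eval cs x

  leading : ∀ {n} → Vec Carrier (suc n) → Carrier
  leading (c ∷ [])     = c
  leading (_ ∷ c ∷ cs) = leading (c ∷ cs)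

  leading-∷ : ∀ {n} c (cs : Vec Carrier (suc n)) → leading (c ∷ cs) ≡ leading cs
  leading-∷ c (d ∷ ds) = ≡.refl

  _⊕_ : ∀ {n} → Vec Carrier (suc n) → Vec Carrier n → Vec Carrier (suc n)
  _⊕_ {zero}  (c ∷ [])  []        = c ∷ []
  _⊕_ {suc n} (c ∷ cs)  (d ∷ ds)  = (c + d) ∷ (cs ⊕ ds)

  eval-⊕ : ∀ {n} (cs : Vec Carrier (suc n)) ds x → eval (cs ⊕ ds) x ≈ eval cs x + eval ds x
  eval-⊕ {zero}  (c ∷ [])  []       x = sym (+-identityʳ _)
  eval-⊕ {suc n} (c ∷ cs)  (d ∷ ds) x = trans (+-congˡ (*-congˡ (eval-⊕ cs ds x)))
    (solve 5 (λ c d x u v → (c :+ d) :+ x :* (u :+ v) := (c :+ x :* u) :+ (d :+ x :* v)) refl c d x (eval cs x) (eval ds x))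

  leading-⊕ : ∀ {n} (cs : Vec Carrier (suc n)) ds → leading (cs ⊕ ds) ≡ leading cs
  leading-⊕ {zero}        (c ∷ [])      []           = ≡.refl
  leading-⊕ {suc zero}    (c ∷ c′ ∷ []) (d ∷ [])     = ≡.refl
  leading-⊕ {suc (suc n)} (c ∷ c′ ∷ cs) (d ∷ d′ ∷ ds) = leading-⊕ (c′ ∷ cs) (d′ ∷ ds)

  eval-scale : ∀ {n} a (cs : Vec Carrier n) x → eval (map (a *_) cs) x ≈ a * eval cs x
  eval-scale a []       x = sym (zeroʳ a)
  eval-scale a (c ∷ cs) x = trans (+-congˡ (*-congˡ (eval-scale a cs x)))
    (solve 4 (λ a c x u → a :* c :+ x :* (a :* u) := a :* (c :+ x :* u)) refl a c x (eval cs x))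

  quotient : ∀ {n} → Carrier → Vec Carrier (suc n) → Vec Carrier n
  quotient {zero}  a (c ∷ [])  = []
  quotient {suc n} a (c ∷ cs) = cs ⊕ map (a *_) (quotient a cs)

  leading-quotient : ∀ {n} a (cs : Vec Carrier (suc (suc n))) → leading (quotient a cs) ≡ leading cs
  leading-quotient a (c ∷ c′ ∷ cs) = leading-⊕ (c′ ∷ cs) _

  eval-quotient : ∀ {n} (cs : Vec Carrier (suc n)) x a → eval cs x - eval cs a ≈ (x - a) * eval (quotient a cs) x
  eval-quotient {zero}  (c ∷ [])  x a = solve 3 (λ c x a → (c :+ x :* con (ℤ.+ 0)) :- (c :+ a :* con (ℤ.+ 0)) := (x :- a) :* con (ℤ.+ 0)) refl c x a
  eval-quotient {suc n} (c ∷ cs) x a = begin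
    (c + x * E x) - (c + a * E a)      ≈⟨ solve 5 (λ c x a u v → (c :+ x :* u) :- (c :+ a :* v) := (x :- a) :* u :+ a :* (u :- v)) refl c x a (E x) (E a) ⟩
    (x - a) * E x + a * (E x - E a)    ≈⟨ +-congˡ (*-congˡ (eval-quotient cs x a)) ⟩
    (x - a) * E x + a * ((x - a) * Q)  ≈⟨ solve 4 (λ x a u w → (x :- a) :* u :+ a :* ((x :- a) :* w) := (x :- a) :* (u :+ a :* w)) refl x a (E x) Q ⟩
    (x - a) * (E x + a * Q)            ≈⟨ *-congˡ (trans (eval-⊕ cs _ x) (+-congˡ (eval-scale a (quotient a cs) x))) ⟨
    (x - a) * eval (quotient a (c ∷ cs)) x ∎
    where
    E : Carrier → Carrier
    E = eval cs
    Q : Carrier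
    Q = eval (quotient a cs) x

  roots≤degree : ∀ d (cs : Vec Carrier (suc d)) → leading cs ≉ 0# →
                 ∀ k (root : Fin k → Carrier) → (∀ i j → root i ≈ root j → i ≡ j) → (∀ i → eval cs (root i) ≈ 0#) → k ≤ d
  roots≤degree d       cs        _  zero    _    _         _      = z≤n
  roots≤degree zero    (c ∷ [])  c≉0 (suc k) root _       isRoot =
    ⊥-elim (c≉0 (trans (sym (trans (+-congˡ (zeroʳ _)) (+-identityʳ c))) (isRoot zero)))
  roots≤degree (suc d) cs        lc≉0 (suc k) root injective isRoot =
    s≤s (roots≤degree d (quotient a cs) (λ lc≈0 → lc≉0 (≡.subst (_≈ 0#) (leading-quotient a cs) lc≈0))
                      k (λ i → root (suc i)) (λ i j e → FinP.suc-injective (injective (suc i) (suc j) e)) isRoot′)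
    where
    a : Carrier
    a = root zero
    isRoot′ : ∀ i → eval (quotient a cs) (root (suc i)) ≈ 0#
    isRoot′ i = zero-product
      (trans (sym (eval-quotient cs (root (suc i)) a)) (x≈y⇒x-y≈0 (trans (isRoot (suc i)) (sym (isRoot zero)))))
      (λ e → FinP.0≢1+n (≡.sym (injective (suc i) zero (x-y≈0⇒x≈y e))))

[1+m]²-1≡m[2+m] : ∀ m → suc m ^ 2 ∸ 1 ≡ m ℕ.* suc (suc m)
[1+m]²-1≡m[2+m] = solve 1 (λ m → m :* con 1 :+ m :* ((con 1 :+ m) :* con 1) := m :* (con 2 :+ m)) ≡.refl
  where open import Data.Nat.Solver using (module +-*-Solver)
        open +-*-Solver

[a*b]*c≡[a*c]*b : ∀ a b c → (a ℕ.* b) ℕ.* c ≡ (a ℕ.* c) ℕ.* b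
[a*b]*c≡[a*c]*b a b c = ≡.trans (ℕP.*-assoc a b c) (≡.trans (≡.cong (a ℕ.*_) (ℕP.*-comm b c)) (≡.sym (ℕP.*-assoc a c b)))

gcd≢1⇒1<gcd : ∀ m k → m ≢ 0 → gcd m k ≢ 1 → 1 < gcd m k
gcd≢1⇒1<gcd m k m≢0 g≢1 = ≢0∧≢1⇒>1 (gcd[m,n]≢0 m k (inj₁ m≢0)) g≢1
  where
  ≢0∧≢1⇒>1 : ∀ {d} → d ≢ 0 → d ≢ 1 → 1 < d
  ≢0∧≢1⇒>1 {zero}        d≢0 _   = ⊥-elim (d≢0 ≡.refl)
  ≢0∧≢1⇒>1 {suc zero}    _   d≢1 = ⊥-elim (d≢1 ≡.refl)
  ≢0∧≢1⇒>1 {suc (suc d)} _   _   = s≤s (s≤s z≤n)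

coprime-if-no-common-divisor : ∀ m k → m ≢ 0 →
  (∀ d → 1 < d → d ∣ m → d ∣ k → ⊥) → gcd m k ≡ 1
coprime-if-no-common-divisor m k m≢0 none with gcd m k ℕ.≟ 1
... | yes g≡1 = g≡1
... | no g≢1  = ⊥-elim (none (gcd m k) (gcd≢1⇒1<gcd m k m≢0 g≢1)
                          (gcd[m,n]∣m m k) (gcd[m,n]∣n m k))

Fin-injective⇒surjective : ∀ {n} (h : Fin n → Fin n) → (∀ {i j} → h i ≡ h j → i ≡ j) → ∀ j → ∃ λ i → h i ≡ j
Fin-injective⇒surjective {zero}  h injective ()
Fin-injective⇒surjective {suc m} h injective j with FinP.any? (λ i → h i Fin.≟ j)
... | yes hit = hit
... | no miss = ⊥-elim (ℕP.<-irrefl ≡.refl (FinP.injective⇒≤ {f = h′} h′-injective))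
  where
  j≢h : ∀ i → j ≢ h i
  j≢h i e = miss (i , ≡.sym e)
  h′ : Fin (suc m) → Fin m
  h′ i = Fin.punchOut (j≢h i)
  h′-injective : ∀ {a b} → h′ a ≡ h′ b → a ≡ b
  h′-injective e = injective (FinP.punchOut-injective (j≢h _) (j≢h _) e)

module FiniteField {c ℓ} (F : Field c ℓ) (N : ℕ) (card : HasCardinality F N) where
  open FieldProperties F
  open Polynomials F
  open Inverse card
  open import Data.Vec using (Vec; []; _∷_)
  open import Data.Fin.Permutation using (Permutation; permutation; _⟨$⟩ʳ_)
  import Algebra.Properties.CommutativeMonoid.Sum as CMSum
  module Π = CMSum *-commutativeMonoid
  module Σ = CMSum +-commutativeMonoid
  open import Algebra.Properties.Semiring.Mult semiring using () renaming (_×_ to _×ₘ_)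

  to-injective : ∀ {x y} → to x ≡ to y → x ≈ y
  to-injective {x} {y} e = trans (sym (strictlyInverseʳ x)) (trans (reflexive (≡.cong from e)) (strictlyInverseʳ y))

  infix 4 _≈?_
  _≈?_ : ∀ x y → Dec (x ≈ y)
  x ≈? y with to x Fin.≟ to y
  ... | yes e = yes (to-injective e)
  ... | no ne = no (λ e → ne (to-cong e))

  from-injective : ∀ i j → from i ≈ from j → i ≡ j
  from-injective i j e = ≡.trans (≡.sym (strictlyInverseˡ i)) (≡.trans (to-cong e) (strictlyInverseˡ j))

  injective⇒surjective : ∀ (f : Carrier → Carrier) → Congruent _≈_ _≈_ f → Injective _≈_ _≈_ f → Surjective _≈_ _≈_ f
  injective⇒surjective f f-cong f-injective y with Fin-injective⇒surjective (λ i → to (f (from i))) h-injective (to y)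
    where
    h-injective : ∀ {i j} → to (f (from i)) ≡ to (f (from j)) → i ≡ j
    h-injective {i} {j} e = from-injective i j (f-injective (to-injective e))
  ... | i , e = from i , λ z≈ → trans (f-cong z≈) (to-injective e)

  reindexing : (σ τ : Carrier → Carrier) → Congruent _≈_ _≈_ σ → Congruent _≈_ _≈_ τ →
               (∀ z → σ (τ z) ≈ z) → (∀ z → τ (σ z) ≈ z) → Permutation N N
  reindexing σ τ σ-cong τ-cong στ τσ = permutation (λ i → to (σ (from i))) (λ j → to (τ (from j)))
    (λ j → ≡.trans (to-cong (trans (σ-cong (strictlyInverseʳ _)) (στ _))) (strictlyInverseˡ j))
    (λ j → ≡.trans (to-cong (trans (τ-cong (strictlyInverseʳ _)) (τσ _))) (strictlyInverseˡ j))

  N≡1+[N-1] : N ≡ suc (N ∸ 1)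
  N≡1+[N-1] = nonEmpty (to 0#)
    where
    nonEmpty : ∀ {M} → Fin M → M ≡ suc (M ∸ 1)
    nonEmpty {suc _} _ = ≡.refl

  N×1≈0 : N ×ₘ 1# ≈ 0#
  N×1≈0 = begin
    N ×ₘ 1#             ≈⟨ solve 2 (λ n s → n := (n :+ s) :- s) refl (N ×ₘ 1#) S ⟩
    (N ×ₘ 1# + S) - S   ≈⟨ +-congʳ translation-invariance ⟩
    (0# + S) - S        ≈⟨ solve 1 (λ s → (con (ℤ.+ 0) :+ s) :- s := con (ℤ.+ 0)) refl S ⟩
    0#                  ∎
    where
    S : Carrier
    S = Σ.sum from
    π : Permutation N N
    π = reindexing (1# +_) (- 1# +_) +-congˡ +-congˡ
          (λ z → trans (sym (+-assoc _ _ _)) (trans (+-congʳ (-‿inverseʳ 1#)) (+-identityˡ z)))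
          (λ z → trans (sym (+-assoc _ _ _)) (trans (+-congʳ (-‿inverseˡ 1#)) (+-identityˡ z)))
    translation-invariance : N ×ₘ 1# + S ≈ 0# + S
    translation-invariance = begin
      N ×ₘ 1# + S                     ≈⟨ +-congʳ (Σ.sum-replicate N) ⟨
      Σ.sum {N} (λ _ → 1#) + S        ≈⟨ Σ.∑-distrib-+ {N} (λ _ → 1#) from ⟨
      Σ.sum {N} (λ i → 1# + from i)   ≈⟨ Σ.sum-cong-≋ {N} (λ i → strictlyInverseʳ (1# + from i)) ⟨
      Σ.sum (λ i → from (π ⟨$⟩ʳ i))   ≈⟨ Σ.sum-permute from π ⟨
      S                               ≈⟨ +-identityˡ S ⟨
      0# + S                          ∎

  private
    unit : Carrier → Carrier
    unit z with z ≈? 0#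
    ... | yes _ = 1#
    ... | no _  = z

    unit-≈0 : ∀ {z} → z ≈ 0# → unit z ≈ 1#
    unit-≈0 {z} z≈0 with z ≈? 0#
    ... | yes _   = refl
    ... | no z≉0 = ⊥-elim (z≉0 z≈0)

    unit-≉0 : ∀ {z} → z ≉ 0# → unit z ≈ z
    unit-≉0 {z} z≉0 with z ≈? 0#
    ... | yes z≈0 = ⊥-elim (z≉0 z≈0)
    ... | no _    = refl

    unit-cong : Congruent _≈_ _≈_ unit
    unit-cong {z} {w} e with z ≈? 0# | w ≈? 0#
    ... | yes _   | yes _   = refl
    ... | yes z≈0 | no w≉0 = ⊥-elim (w≉0 (trans (sym e) z≈0))
    ... | no z≉0 | yes w≈0 = ⊥-elim (z≉0 (trans e w≈0))
    ... | no _    | no _    = e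

    unit-nonZero : ∀ z → unit z ≉ 0#
    unit-nonZero z with z ≈? 0#
    ... | yes _   = 1#≉0#
    ... | no z≉0 = z≉0

    offDiagonal : ∀ {n} → Carrier → Fin n → Fin n → Carrier
    offDiagonal x zero    zero    = 1#
    offDiagonal x zero    (suc j) = x
    offDiagonal x (suc i) zero    = x
    offDiagonal x (suc i) (suc j) = offDiagonal x i j

    offDiagonal-≡ : ∀ {n} x (i : Fin n) → offDiagonal x i i ≈ 1#
    offDiagonal-≡ x zero    = refl
    offDiagonal-≡ x (suc i) = offDiagonal-≡ x i

    offDiagonal-≢ : ∀ {n} x (i j : Fin n) → i ≢ j → offDiagonal x i j ≈ x
    offDiagonal-≢ x zero    zero    i≢j = ⊥-elim (i≢j ≡.refl)
    offDiagonal-≢ x zero    (suc j) _   = refl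
    offDiagonal-≢ x (suc i) zero    _   = refl
    offDiagonal-≢ x (suc i) (suc j) i≢j = offDiagonal-≢ x i j (λ e → i≢j (≡.cong suc e))

    Π-const : ∀ n x → Π.sum {n} (λ _ → x) ≈ pow x n
    Π-const zero    x = refl
    Π-const (suc n) x = *-congˡ (Π-const n x)

    Π-offDiagonal : ∀ {n} x (j : Fin n) → Π.sum (λ i → offDiagonal x i j) ≈ pow x (n ∸ 1)
    Π-offDiagonal {suc zero}    x zero    = *-identityˡ _
    Π-offDiagonal {suc (suc n)} x zero    = trans (*-identityˡ _) (Π-const (suc n) x)
    Π-offDiagonal {suc (suc n)} x (suc j) = *-congˡ (Π-offDiagonal x j)

    Π-nonZero : ∀ n (t : Fin n → Carrier) → (∀ i → t i ≉ 0#) → Π.sum t ≉ 0#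
    Π-nonZero zero    t _       = 1#≉0#
    Π-nonZero (suc n) t t≉0 = *-nonZero (t≉0 zero) (Π-nonZero n (λ i → t (suc i)) (λ i → t≉0 (suc i)))

  -- Multiplication by x permutes F; compare the products of unit z (z with 0 replaced by 1) before and after.
  fermat : ∀ x → x ≉ 0# → pow x (N ∸ 1) ≈ 1#
  fermat x x≉0 = *-cancelʳ (Π-nonZero N (λ i → unit (from i)) (λ i → unit-nonZero _)) (begin
    pow x (N ∸ 1) * P                           ≈⟨ *-congʳ (Π-offDiagonal x i₀) ⟨
    Π.sum factor * P                            ≈⟨ Π.∑-distrib-+ factor (λ i → unit (from i)) ⟨
    Π.sum (λ i → factor i * unit (from i))      ≈⟨ Π.sum-cong-≋ {N} unit-scaled ⟨
    Π.sum (λ i → unit (from (π ⟨$⟩ʳ i)))        ≈⟨ Π.sum-permute (λ i → unit (from i)) π ⟨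
    P                                           ≈⟨ *-identityˡ P ⟨
    1# * P                                      ∎)
    where
    P : Carrier
    P = Π.sum (λ i → unit (from i))
    π : Permutation N N
    π = reindexing (x *_) (x ⁻¹ *_) *-congˡ *-congˡ
          (λ z → trans (sym (*-assoc _ _ _)) (trans (*-congʳ (⁻¹-inverse x x≉0)) (*-identityˡ z)))
          (λ z → trans (sym (*-assoc _ _ _)) (trans (*-congʳ (⁻¹-inverseˡ x x≉0)) (*-identityˡ z)))
    i₀ : Fin N
    i₀ = to 0#
    factor : Fin N → Carrier
    factor i = offDiagonal x i i₀
    unit-scaled : ∀ i → unit (from (π ⟨$⟩ʳ i)) ≈ factor i * unit (from i)
    unit-scaled i with i Fin.≟ i₀
    ... | yes ≡.refl = begin
      unit (from (to (x * from i₀)))   ≈⟨ unit-≈0 (trans (strictlyInverseʳ _) (trans (*-congˡ (strictlyInverseʳ 0#)) (zeroʳ x))) ⟩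
      1#                               ≈⟨ *-identityˡ 1# ⟨
      1# * 1#                          ≈⟨ *-cong (offDiagonal-≡ x i₀) (unit-≈0 (strictlyInverseʳ 0#)) ⟨
      factor i₀ * unit (from i₀)       ∎
    ... | no i≢i₀ = begin
      unit (from (to (x * from i)))    ≈⟨ unit-cong (strictlyInverseʳ _) ⟩
      unit (x * from i)                ≈⟨ unit-≉0 (*-nonZero x≉0 from-i≉0) ⟩
      x * from i                       ≈⟨ *-cong (offDiagonal-≢ x i i₀ i≢i₀) (unit-≉0 from-i≉0) ⟨
      factor i * unit (from i)         ∎
      where
      from-i≉0 : from i ≉ 0#
      from-i≉0 e = i≢i₀ (≡.trans (≡.sym (strictlyInverseˡ i)) (to-cong e))

  private
    xᵐ : ∀ m → Vec Carrier (suc m)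
    xᵐ zero    = 1# ∷ []
    xᵐ (suc m) = 0# ∷ xᵐ m

    eval-xᵐ : ∀ m x → eval (xᵐ m) x ≈ pow x m
    eval-xᵐ zero    x = trans (+-congˡ (zeroʳ x)) (+-identityʳ 1#)
    eval-xᵐ (suc m) x = trans (+-identityˡ _) (*-congˡ (eval-xᵐ m x))

    leading-xᵐ : ∀ m → leading (xᵐ m) ≡ 1#
    leading-xᵐ zero    = ≡.refl
    leading-xᵐ (suc m) = ≡.trans (leading-∷ 0# (xᵐ m)) (leading-xᵐ m)

  -- If y ^ m ≈ κ held for every y ≉ 0, every element would be a root of X ^ (m + 1) - κ X.
  ∃-non-root : ∀ m κ → 1 ≤ m → m < N ∸ 1 → ∃ λ y → y ≉ 0# × pow y m ≉ κ
  ∃-non-root (suc m) κ _ m<N-1 with FinP.any? {n = N} (λ i → ¬? (from i ≈? 0#) ×-dec ¬? (pow (from i) (suc m) ≈? κ))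
    where open import Relation.Nullary.Decidable using (_×-dec_; ¬?)
  ... | yes (i , from-i≉0 , from-iᵐ≉κ) = from i , from-i≉0 , from-iᵐ≉κ
  ... | no none = ⊥-elim (ℕP.<⇒≱ (≡.subst (suc (suc m) <_) (≡.sym N≡1+[N-1]) (s≤s m<N-1))
                    (roots≤degree (suc (suc m)) Xᵐ⁺¹-κX leading≉0 N from from-injective isRoot))
    where
    Xᵐ⁺¹-κX : Vec Carrier (suc (suc (suc m)))
    Xᵐ⁺¹-κX = 0# ∷ (- κ) ∷ xᵐ m
    leading≉0 : leading Xᵐ⁺¹-κX ≉ 0#
    leading≉0 e = 1#≉0# (≡.subst (_≈ 0#) (≡.trans (leading-∷ 0# ((- κ) ∷ xᵐ m)) (≡.trans (leading-∷ (- κ) (xᵐ m)) (leading-xᵐ m))) e)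
    eval-Xᵐ⁺¹-κX : ∀ y → eval Xᵐ⁺¹-κX y ≈ y * (pow y (suc m) - κ)
    eval-Xᵐ⁺¹-κX y = begin
      0# + y * (- κ + y * eval (xᵐ m) y)   ≈⟨ +-congˡ (*-congˡ (+-congˡ (*-congˡ (eval-xᵐ m y)))) ⟩
      0# + y * (- κ + y * pow y m)         ≈⟨ solve 3 (λ y k p → con (ℤ.+ 0) :+ y :* (:- k :+ y :* p) := y :* (y :* p :- k)) refl y κ (pow y m) ⟩
      y * (pow y (suc m) - κ)              ∎
    isRoot : ∀ i → eval Xᵐ⁺¹-κX (from i) ≈ 0#
    isRoot i with from i ≈? 0# | pow (from i) (suc m) ≈? κ
    ... | yes y≈0 | _        = trans (eval-Xᵐ⁺¹-κX _) (trans (*-congʳ y≈0) (zeroˡ _))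
    ... | no _    | yes yᵐ≈κ = trans (eval-Xᵐ⁺¹-κX _) (trans (*-congˡ (x≈y⇒x-y≈0 yᵐ≈κ)) (zeroʳ _))
    ... | no y≉0 | no yᵐ≉κ  = ⊥-elim (none (i , y≉0 , yᵐ≉κ))

  1≤N∸1 : 1 ≤ N ∸ 1
  1≤N∸1 = twoDistinct (to 0#) (to 1#) (λ e → 0≉1 (to-injective e))
    where
    twoDistinct : ∀ {M} (i j : Fin M) → i ≢ j → 1 ≤ M ∸ 1
    twoDistinct {suc zero}    zero zero i≢j = ⊥-elim (i≢j ≡.refl)
    twoDistinct {suc (suc M)} _    _    _   = s≤s z≤n

  ∃-pow≉1 : ∀ m d → m ℕ.* d ≡ N ∸ 1 → 1 < d → ∃ λ y → y ≉ 0# × pow y m ≉ 1#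
  ∃-pow≉1 zero    d md≡N-1 _   = ⊥-elim (ℕP.<⇒≢ 1≤N∸1 md≡N-1)
  ∃-pow≉1 (suc m) d md≡N-1 1<d = ∃-non-root (suc m) 1# (s≤s z≤n)
    (≡.subst (suc m <_) md≡N-1 (ℕP.m<m*n (suc m) d 1<d))

module FieldOfSquareOrder {c ℓ} (F : Field c ℓ) (q : ℕ) (q-primePower : IsPrimePower q)
                          (card : HasCardinality F (q ^ 2)) where
  open FieldProperties F public
  open FiniteField F (q ^ 2) card public
  open import Data.Nat.Primality using (Prime)
  open import Algebra.Properties.Semiring.Mult semiring using (×1-homo-*; ×-homo-1) renaming (_×_ to _×ₘ_)

  p : ℕ
  p = proj₁ q-primePower

  k : ℕ
  k = proj₁ (proj₂ q-primePower)

  p-prime : Prime p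
  p-prime = proj₁ (proj₂ (proj₂ q-primePower))

  k≥1 : k ≥ 1
  k≥1 = proj₁ (proj₂ (proj₂ (proj₂ q-primePower)))

  q≡p^k : q ≡ p ^ k
  q≡p^k = proj₂ (proj₂ (proj₂ (proj₂ q-primePower)))

  q-1 q+1 : ℕ
  q-1 = q ∸ 1
  q+1 = suc q

  q≥2 : 2 ≤ q
  q≥2 = ≡.subst (2 ≤_) (≡.sym q≡p^k) (p^k≥2 k k≥1)
    where
    p^k≥2 : ∀ k → 1 ≤ k → 2 ≤ p ^ k
    p^k≥2 (suc zero)    _ = ≡.subst (2 ≤_) (≡.sym (ℕP.*-identityʳ p)) (prime>1 p-prime)
    p^k≥2 (suc (suc k)) _ = ℕP.≤-trans (p^k≥2 (suc k) (s≤s z≤n))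
      (ℕP.m≤n*m (p ^ suc k) p ⦃ ℕ.>-nonZero (ℕP.<-trans (s≤s z≤n) (prime>1 p-prime)) ⦄)

  q≡1+[q-1] : q ≡ suc q-1
  q≡1+[q-1] = go q≥2
    where
    go : ∀ {m} → 2 ≤ m → m ≡ suc (m ∸ 1)
    go (s≤s _) = ≡.refl

  q²-1≡[q-1][q+1] : q ^ 2 ∸ 1 ≡ q-1 ℕ.* q+1
  q²-1≡[q-1][q+1] = ≡.subst (λ m → m ^ 2 ∸ 1 ≡ (m ∸ 1) ℕ.* suc m) (≡.sym q≡1+[q-1]) ([1+m]²-1≡m[2+m] q-1)

  cofactor-of-q-1 : ∀ t d → q-1 ≡ t ℕ.* d → (t ℕ.* q+1) ℕ.* d ≡ q ^ 2 ∸ 1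
  cofactor-of-q-1 t d q-1≡td = ≡.trans ([a*b]*c≡[a*c]*b t q+1 d)
    (≡.trans (≡.cong (ℕ._* q+1) (≡.sym q-1≡td)) (≡.sym q²-1≡[q-1][q+1]))

  cofactor-of-q+1 : ∀ e d → q+1 ≡ e ℕ.* d → (q-1 ℕ.* e) ℕ.* d ≡ q ^ 2 ∸ 1
  cofactor-of-q+1 e d q+1≡ed = ≡.trans (ℕP.*-assoc q-1 e d)
    (≡.trans (≡.cong (q-1 ℕ.*_) (≡.sym q+1≡ed)) (≡.sym q²-1≡[q-1][q+1]))

  pow-q : ∀ x → pow x q ≈ x * pow x q-1
  pow-q x = reflexive (≡.cong (pow x) q≡1+[q-1])

  0^q≈0 : pow 0# q ≈ 0#
  0^q≈0 = trans (pow-q 0#) (zeroˡ _)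

  fermat-q² : ∀ x → x ≉ 0# → pow x (q-1 ℕ.* q+1) ≈ 1#
  fermat-q² x x≉0 = ≡.subst (λ m → pow x m ≈ 1#) q²-1≡[q-1][q+1] (fermat x x≉0)

  pow-q-1-∈μ : ∀ x → x ≉ 0# → pow (pow x q-1) q+1 ≈ 1#
  pow-q-1-∈μ x x≉0 = trans (sym (pow-* x q-1 q+1)) (fermat-q² x x≉0)

  frobenius-involutive : ∀ x → pow (pow x q) q ≈ x
  frobenius-involutive x with x ≈? 0#
  ... | yes x≈0 = trans (pow-cong q (trans (pow-cong q x≈0) 0^q≈0)) (trans 0^q≈0 (sym x≈0))
  ... | no x≉0 = begin
    pow (pow x q) q             ≈⟨ pow-* x q q ⟨
    pow x (q ℕ.* q)             ≡⟨ ≡.cong (λ m → pow x (q ℕ.* m)) (ℕP.*-identityʳ q) ⟨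
    pow x (q ^ 2)               ≡⟨ ≡.cong (pow x) N≡1+[N-1] ⟩
    x * pow x (q ^ 2 ∸ 1)       ≈⟨ *-congˡ (fermat x x≉0) ⟩
    x * 1#                      ≈⟨ *-identityʳ x ⟩
    x                           ∎

  char-p : p ×ₘ 1# ≈ 0#
  char-p with (p ×ₘ 1#) ≈? 0#
  ... | yes p≈0 = p≈0
  ... | no p≉0 = ⊥-elim (*-nonZero q≉0 (*-nonZero q≉0 1≉0) (trans (sym q²×1) N×1≈0))
    where
    p^m×1 : ∀ m → (p ^ m) ×ₘ 1# ≈ pow (p ×ₘ 1#) m
    p^m×1 zero    = ×-homo-1 1#
    p^m×1 (suc m) = trans (×1-homo-* p (p ^ m)) (*-congˡ (p^m×1 m))
    q≉0 : q ×ₘ 1# ≉ 0#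
    q≉0 e = pow-nonZero k p≉0 (trans (sym (≡.subst (λ m → m ×ₘ 1# ≈ pow (p ×ₘ 1#) k) (≡.sym q≡p^k) (p^m×1 k))) e)
    1≉0 : 1 ×ₘ 1# ≉ 0#
    1≉0 e = 1#≉0# (trans (sym (×-homo-1 1#)) e)
    q²×1 : (q ^ 2) ×ₘ 1# ≈ (q ×ₘ 1#) * ((q ×ₘ 1#) * (1 ×ₘ 1#))
    q²×1 = trans (×1-homo-* q (q ℕ.* 1)) (*-congˡ (×1-homo-* q 1))

  frobenius-+ : ∀ x y → pow (x + y) q ≈ pow x q + pow y q
  frobenius-+ x y = ≡.subst (λ m → pow (x + y) m ≈ pow x m + pow y m) (≡.sym q≡p^k)
    (Frobenius.pow-prime^-+ F p-prime char-p k x y)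

  frobenius-neg : ∀ x → pow (- x) q ≈ - pow x q
  frobenius-neg x = begin
    pow (- x) q                         ≈⟨ solve 2 (λ u v → u := (u :+ v) :- v) refl (pow (- x) q) (pow x q) ⟩
    (pow (- x) q + pow x q) - pow x q   ≈⟨ +-congʳ (frobenius-+ (- x) x) ⟨
    pow (- x + x) q - pow x q           ≈⟨ +-congʳ (trans (pow-cong q (-‿inverseˡ x)) 0^q≈0) ⟩
    0# - pow x q                        ≈⟨ +-identityˡ _ ⟩
    - pow x q                           ∎

  frobenius-sub : ∀ x y → pow (x - y) q ≈ pow x q - pow y q
  frobenius-sub x y = trans (frobenius-+ x (- y)) (+-congˡ (frobenius-neg y))

  ∈𝔽q⇒frobenius-fixed : ∀ {x} → pow x q-1 ≈ 1# → pow x q ≈ x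
  ∈𝔽q⇒frobenius-fixed {x} e = trans (pow-q x) (trans (*-congˡ e) (*-identityʳ x))

module TwistedTrace {c ℓ} (F : Field c ℓ) (q : ℕ) (q-primePower : IsPrimePower q)
                    (card : HasCardinality F (q ^ 2)) (v : Field.Carrier F)
                    (v≉0 : ¬ Field._≈_ F v (Field.0# F))
                    (v∉μ : ¬ Field._≈_ F (Field.pow F v (suc q)) (Field.1# F)) where
  open FieldOfSquareOrder F q q-primePower card

  v̄ : Carrier
  v̄ = pow v q

  v̄̄≈v : pow v̄ q ≈ v
  v̄̄≈v = frobenius-involutive v

  s : Carrier → Carrier
  s x = x + v̄ * pow x q

  s-cong : Congruent _≈_ _≈_ s
  s-cong e = +-cong e (*-congˡ (pow-cong q e))

  s-0# : s 0# ≈ 0#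
  s-0# = trans (+-congˡ (trans (*-congˡ 0^q≈0) (zeroʳ v̄))) (+-identityˡ 0#)

  s-frobenius : ∀ x → pow (s x) q ≈ pow x q + v * x
  s-frobenius x = trans (frobenius-+ x (v̄ * pow x q))
    (+-congˡ (trans (pow-distrib-* v̄ (pow x q) q) (*-cong v̄̄≈v (frobenius-involutive x))))

  s-scale : ∀ l x → pow l q ≈ l → s (l * x) ≈ l * s x
  s-scale l x lᵠ≈l = begin
    l * x + v̄ * pow (l * x) q     ≈⟨ +-congˡ (*-congˡ (trans (pow-distrib-* l x q) (*-congʳ lᵠ≈l))) ⟩
    l * x + v̄ * (l * pow x q)     ≈⟨ solve 4 (λ l x v̄ xᵠ → l :* x :+ v̄ :* (l :* xᵠ) := l :* (x :+ v̄ :* xᵠ)) refl l x v̄ (pow x q) ⟩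
    l * s x                       ∎

  1-vv̄≉0 : 1# - v * v̄ ≉ 0#
  1-vv̄≉0 e = v∉μ (sym (x-y≈0⇒x≈y e))

  [1-vv̄]ᵠ≈1-vv̄ : pow (1# - v * v̄) q ≈ 1# - v * v̄
  [1-vv̄]ᵠ≈1-vv̄ = begin
    pow (1# - v * v̄) q             ≈⟨ frobenius-sub 1# (v * v̄) ⟩
    pow 1# q - pow (v * v̄) q       ≈⟨ +-cong (pow-1# q) (-‿cong (trans (pow-distrib-* v v̄ q) (trans (*-congˡ v̄̄≈v) (*-comm v̄ v)))) ⟩
    1# - v * v̄                     ∎

  -- Eliminating x ^ q between s x and (s x) ^ q.
  [1-vv̄]x≈s-v̄sᵠ : ∀ x → (1# - v * v̄) * x ≈ s x - v̄ * pow (s x) q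
  [1-vv̄]x≈s-v̄sᵠ x = begin
    (1# - v * v̄) * x                 ≈⟨ [1-u]*x≈x-u*x (v * v̄) x ⟩
    x - (v * v̄) * x                  ≈⟨ solve 4 (λ x v v̄ xᵠ → x :- (v :* v̄) :* x := (x :+ v̄ :* xᵠ) :- v̄ :* (xᵠ :+ v :* x)) refl x v v̄ (pow x q) ⟩
    s x - v̄ * (pow x q + v * x)      ≈⟨ +-congˡ (-‿cong (*-congˡ (s-frobenius x))) ⟨
    s x - v̄ * pow (s x) q            ∎

  s-injective : Injective _≈_ _≈_ s
  s-injective {x} {y} e = *-cancelˡ 1-vv̄≉0 (begin
    (1# - v * v̄) * x                 ≈⟨ [1-vv̄]x≈s-v̄sᵠ x ⟩
    s x - v̄ * pow (s x) q            ≈⟨ +-cong e (-‿cong (*-congˡ (pow-cong q e))) ⟩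
    s y - v̄ * pow (s y) q            ≈⟨ [1-vv̄]x≈s-v̄sᵠ y ⟨
    (1# - v * v̄) * y                 ∎)

  s-nonZero : ∀ {x} → x ≉ 0# → s x ≉ 0#
  s-nonZero x≉0 sx≈0 = x≉0 (s-injective (trans sx≈0 (sym s-0#)))

  s⁻¹ : Carrier → Carrier
  s⁻¹ y = (1# - v * v̄) ⁻¹ * (y - v̄ * pow y q)

  s∘s⁻¹ : ∀ y → s (s⁻¹ y) ≈ y
  s∘s⁻¹ y = begin
    s (κ * z)                     ≈⟨ s-scale κ z κᵠ≈κ ⟩
    κ * s z                       ≈⟨ *-congˡ sz≈[1-vv̄]y ⟩
    κ * ((1# - v * v̄) * y)        ≈⟨ *-assoc _ _ _ ⟨
    (κ * (1# - v * v̄)) * y        ≈⟨ *-congʳ (⁻¹-inverseˡ _ 1-vv̄≉0) ⟩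
    1# * y                        ≈⟨ *-identityˡ y ⟩
    y                             ∎
    where
    κ z : Carrier
    κ = (1# - v * v̄) ⁻¹
    z = y - v̄ * pow y q
    κᵠ≈κ : pow κ q ≈ κ
    κᵠ≈κ = trans (pow-⁻¹ _ q 1-vv̄≉0) (⁻¹-cong (pow-nonZero q 1-vv̄≉0) [1-vv̄]ᵠ≈1-vv̄)
    sz≈[1-vv̄]y : s z ≈ (1# - v * v̄) * y
    sz≈[1-vv̄]y = begin
      z + v̄ * pow z q                                 ≈⟨ +-congˡ (*-congˡ (trans (frobenius-sub y _) (+-congˡ (-‿cong
                                                          (trans (pow-distrib-* v̄ _ q) (*-cong v̄̄≈v (frobenius-involutive y))))))) ⟩
      (y - v̄ * pow y q) + v̄ * (pow y q - v * y)       ≈⟨ solve 4 (λ y yᵠ v̄ v → (y :- v̄ :* yᵠ) :+ v̄ :* (yᵠ :- v :* y) := y :- (v :* v̄) :* y) refl y (pow y q) v̄ v ⟩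
      y - (v * v̄) * y                                 ≈⟨ [1-u]*x≈x-u*x (v * v̄) y ⟨
      (1# - v * v̄) * y                                ∎

module PermutationCriterion
  {c ℓ} (F : Field c ℓ) (q : ℕ) (q-primePower : IsPrimePower q) (card : HasCardinality F (q ^ 2))
  (r n : ℕ) (r≢0 : r ≢ 0) (n≢0 : n ≢ 0) (r≡n : r % suc q ≡ n % suc q)
  (a b v : Field.Carrier F)
  (a≉0 : ¬ Field._≈_ F a (Field.0# F)) (b≉0 : ¬ Field._≈_ F b (Field.0# F)) (v≉0 : ¬ Field._≈_ F v (Field.0# F))
  (v∉μ : ¬ Field._≈_ F (Field.pow F v (suc q)) (Field.1# F)) where
  open FieldOfSquareOrder F q q-primePower card
  open TwistedTrace F q q-primePower card v v≉0 v∉μ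

  w : Carrier
  w = pow (v ⁻¹) q

  B : Carrier → Carrier
  B X = (a * pow (X + w) n) + (b * pow (X + v) n)

  f : Carrier → Carrier
  f X = pow X r * B (pow X q-1)

  A α : Carrier
  A = a * pow w n
  α = pow a q * pow (v ⁻¹) n

  σ τ E G : Carrier → Carrier
  σ x = pow (s x) q-1
  τ x = pow (σ x) n
  E x = A + b * τ x
  G x = pow (s x) n * E x

  ρ : Carrier
  ρ = (b * pow v n) * (a ⁻¹)

  B-cong : Congruent _≈_ _≈_ B
  B-cong e = +-cong (*-congˡ (pow-cong n (+-congʳ e))) (*-congˡ (pow-cong n (+-congʳ e)))

  f-cong : Congruent _≈_ _≈_ f
  f-cong e = *-cong (pow-cong r e) (B-cong (pow-cong q-1 e))

  w*v̄≈1 : w * v̄ ≈ 1#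
  w*v̄≈1 = pow-*≈1 q (⁻¹-inverseˡ v v≉0)

  x*[xᵠ⁻¹+w]≈w*s : ∀ x → x * (pow x q-1 + w) ≈ w * s x
  x*[xᵠ⁻¹+w]≈w*s x = begin
    x * (pow x q-1 + w)          ≈⟨ solve 3 (λ x y w → x :* (y :+ w) := x :* y :+ x :* w) refl x (pow x q-1) w ⟩
    x * pow x q-1 + x * w        ≈⟨ +-congʳ (pow-q x) ⟨
    pow x q + x * w              ≈⟨ +-congʳ (trans (*-congʳ w*v̄≈1) (*-identityˡ _)) ⟨
    (w * v̄) * pow x q + x * w    ≈⟨ solve 4 (λ x w v̄ xᵠ → (w :* v̄) :* xᵠ :+ x :* w := w :* (x :+ v̄ :* xᵠ)) refl x w v̄ (pow x q) ⟩
    w * s x                      ∎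

  x*[xᵠ⁻¹+v]≈sᵠ : ∀ x → x * (pow x q-1 + v) ≈ pow (s x) q
  x*[xᵠ⁻¹+v]≈sᵠ x = begin
    x * (pow x q-1 + v)          ≈⟨ solve 3 (λ x y v → x :* (y :+ v) := x :* y :+ v :* x) refl x (pow x q-1) v ⟩
    x * pow x q-1 + v * x        ≈⟨ +-congʳ (pow-q x) ⟨
    pow x q + v * x              ≈⟨ s-frobenius x ⟨
    pow (s x) q                  ∎

  -- After multiplying by x, both linear factors of B (x ^ (q - 1)) become multiples of s x.
  xⁿ*B≈G : ∀ x → pow x n * B (pow x q-1) ≈ G x
  xⁿ*B≈G x = begin
    pow x n * (a * pow (pow x q-1 + w) n + b * pow (pow x q-1 + v) n)
      ≈⟨ solve 4 (λ z a P Q → z :* (a :* P :+ Q) := a :* (z :* P) :+ (z :* Q)) refl (pow x n) a (pow (pow x q-1 + w) n) (b * pow (pow x q-1 + v) n) ⟩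
    a * (pow x n * pow (pow x q-1 + w) n) + pow x n * (b * pow (pow x q-1 + v) n)
      ≈⟨ +-cong (*-congˡ (sym (pow-distrib-* _ _ n))) (solve 3 (λ z b P → z :* (b :* P) := b :* (z :* P)) refl (pow x n) b _) ⟩
    a * pow (x * (pow x q-1 + w)) n + b * (pow x n * pow (pow x q-1 + v) n)
      ≈⟨ +-cong (*-congˡ (pow-cong n (x*[xᵠ⁻¹+w]≈w*s x))) (*-congˡ (sym (pow-distrib-* _ _ n))) ⟩
    a * pow (w * s x) n + b * pow (x * (pow x q-1 + v)) n
      ≈⟨ +-cong (*-congˡ (pow-distrib-* w (s x) n)) (*-congˡ (pow-cong n (trans (x*[xᵠ⁻¹+v]≈sᵠ x) (pow-q (s x))))) ⟩
    a * (pow w n * pow (s x) n) + b * pow (s x * σ x) n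
      ≈⟨ +-congˡ (*-congˡ (pow-distrib-* (s x) (σ x) n)) ⟩
    a * (pow w n * pow (s x) n) + b * (pow (s x) n * τ x)
      ≈⟨ solve 5 (λ a wⁿ sⁿ b t → a :* (wⁿ :* sⁿ) :+ b :* (sⁿ :* t) := sⁿ :* (a :* wⁿ :+ b :* t)) refl a (pow w n) (pow (s x) n) b (τ x) ⟩
    G x ∎

  xⁿ*f≈xʳ*G : ∀ x → pow x n * f x ≈ pow x r * G x
  xⁿ*f≈xʳ*G x = begin
    pow x n * (pow x r * B (pow x q-1)) ≈⟨ solve 3 (λ u t z → u :* (t :* z) := t :* (u :* z)) refl (pow x n) (pow x r) _ ⟩
    pow x r * (pow x n * B (pow x q-1)) ≈⟨ *-congˡ (xⁿ*B≈G x) ⟩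
    pow x r * G x                       ∎

  f^[q-1]≈G^[q-1] : ∀ x → x ≉ 0# → pow (f x) q-1 ≈ pow (G x) q-1
  f^[q-1]≈G^[q-1] x x≉0 = *-cancelˡ (pow-nonZero n (pow-nonZero q-1 x≉0)) (begin
    pow (pow x q-1) n * pow (f x) q-1    ≈⟨ *-congʳ (pow-pow-comm x q-1 n) ⟩
    pow (pow x n) q-1 * pow (f x) q-1    ≈⟨ pow-distrib-* _ _ q-1 ⟨
    pow (pow x n * f x) q-1              ≈⟨ pow-cong q-1 (xⁿ*f≈xʳ*G x) ⟩
    pow (pow x r * G x) q-1              ≈⟨ pow-distrib-* _ _ q-1 ⟩
    pow (pow x r) q-1 * pow (G x) q-1    ≈⟨ *-congʳ (pow-pow-comm x r q-1) ⟩
    pow (pow x q-1) r * pow (G x) q-1    ≈⟨ *-congʳ (pow-mod q+1 r n r≡n (pow-q-1-∈μ x x≉0)) ⟩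
    pow (pow x q-1) n * pow (G x) q-1    ∎)

  τ*τᵠ≈1 : ∀ x → x ≉ 0# → τ x * pow (τ x) q ≈ 1#
  τ*τᵠ≈1 x x≉0 = trans (pow-pow-comm (σ x) n q+1) (trans (pow-cong n (pow-q-1-∈μ (s x) (s-nonZero x≉0))) (pow-1# n))

  -- Both sides are G x ^ q divided by s x ^ n.
  E*G^[q-1]≈ατ+bᵠ : ∀ x → x ≉ 0# → E x * pow (G x) q-1 ≈ α * τ x + pow b q
  E*G^[q-1]≈ατ+bᵠ x x≉0 = *-cancelˡ (pow-nonZero n (s-nonZero x≉0)) (begin
    pow (s x) n * (E x * pow (G x) q-1)                    ≈⟨ *-assoc _ _ _ ⟨
    G x * pow (G x) q-1                                    ≈⟨ pow-q (G x) ⟨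
    pow (G x) q                                            ≈⟨ pow-distrib-* _ _ q ⟩
    pow (pow (s x) n) q * pow (E x) q                      ≈⟨ *-cong (pow-pow-comm (s x) n q) (frobenius-+ _ _) ⟩
    pow (pow (s x) q) n * (pow A q + pow (b * τ x) q)      ≈⟨ *-cong (trans (pow-cong n (pow-q (s x))) (pow-distrib-* _ _ n))
                                                                      (+-cong (pow-distrib-* _ _ q) (pow-distrib-* _ _ q)) ⟩
    (pow (s x) n * τ x) * (pow a q * pow (pow w n) q + pow b q * pow (τ x) q)
      ≈⟨ *-congˡ (+-congʳ (*-congˡ (trans (pow-pow-comm w n q) (pow-cong n (frobenius-involutive (v ⁻¹)))))) ⟩
    (pow (s x) n * τ x) * (α + pow b q * pow (τ x) q)
      ≈⟨ solve 5 (λ S t α bᵠ T → (S :* t) :* (α :+ bᵠ :* T) := S :* (α :* t :+ bᵠ :* (t :* T))) refl (pow (s x) n) (τ x) α (pow b q) (pow (τ x) q) ⟩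
    pow (s x) n * (α * τ x + pow b q * (τ x * pow (τ x) q))  ≈⟨ *-congˡ (+-congˡ (trans (*-congˡ (τ*τᵠ≈1 x x≉0)) (*-identityʳ _))) ⟩
    pow (s x) n * (α * τ x + pow b q)                      ∎)

  f-homogeneous : ∀ l x → pow l q-1 ≈ 1# → f (l * x) ≈ pow l r * f x
  f-homogeneous l x lᵠ⁻¹≈1 = begin
    pow (l * x) r * B (pow (l * x) q-1)   ≈⟨ *-cong (pow-distrib-* l x r) (B-cong (trans (pow-distrib-* l x q-1) (trans (*-congʳ lᵠ⁻¹≈1) (*-identityˡ _)))) ⟩
    (pow l r * pow x r) * B (pow x q-1)   ≈⟨ *-assoc _ _ _ ⟩
    pow l r * f x                         ∎

  f-0# : f 0# ≈ 0#
  f-0# = trans (*-congʳ (pow-0# r r≢0)) (zeroˡ _)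

  αA*ρ^[q+1]≈bᵠb : (α * A) * pow ρ q+1 ≈ pow b q * b
  αA*ρ^[q+1]≈bᵠb = begin
    (α * A) * pow ρ q+1
      ≈⟨ *-congˡ (trans (pow-distrib-* _ _ q+1) (*-congʳ (pow-distrib-* b (pow v n) q+1))) ⟩
    (α * A) * ((pow b q+1 * pow (pow v n) q+1) * pow (a ⁻¹) q+1)
      ≈⟨ *-congˡ (*-congʳ (*-congˡ (*-congˡ (pow-pow-comm v n q)))) ⟩
    ((aᵠ * v⁻ⁿ) * (a * wⁿ)) * (((b * bᵠ) * (vⁿ * v̄ⁿ)) * (a⁻¹ * a⁻ᵠ))
      ≈⟨ solve 10 (λ aᵠ v⁻ⁿ a wⁿ b bᵠ vⁿ v̄ⁿ a⁻¹ a⁻ᵠ →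
            ((aᵠ :* v⁻ⁿ) :* (a :* wⁿ)) :* (((b :* bᵠ) :* (vⁿ :* v̄ⁿ)) :* (a⁻¹ :* a⁻ᵠ))
            := (a :* a⁻¹) :* ((aᵠ :* a⁻ᵠ) :* ((v⁻ⁿ :* vⁿ) :* ((wⁿ :* v̄ⁿ) :* (bᵠ :* b)))))
          refl aᵠ v⁻ⁿ a wⁿ b bᵠ vⁿ v̄ⁿ a⁻¹ a⁻ᵠ ⟩
    (a * a⁻¹) * ((aᵠ * a⁻ᵠ) * ((v⁻ⁿ * vⁿ) * ((wⁿ * v̄ⁿ) * (bᵠ * b))))
      ≈⟨ *-cong (⁻¹-inverse a a≉0) (*-cong (pow-*≈1 q (⁻¹-inverse a a≉0))
           (*-cong (pow-*≈1 n (⁻¹-inverseˡ v v≉0)) (*-congʳ (pow-*≈1 n w*v̄≈1)))) ⟩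
    1# * (1# * (1# * (1# * (bᵠ * b))))
      ≈⟨ trans (*-identityˡ _) (trans (*-identityˡ _) (trans (*-identityˡ _) (*-identityˡ _))) ⟩
    bᵠ * b ∎
    where
    aᵠ a⁻¹ a⁻ᵠ bᵠ vⁿ v̄ⁿ v⁻ⁿ wⁿ : Carrier
    aᵠ  = pow a q
    a⁻¹ = a ⁻¹
    a⁻ᵠ = pow (a ⁻¹) q
    bᵠ  = pow b q
    vⁿ  = pow v n
    v̄ⁿ  = pow v̄ n
    v⁻ⁿ = pow (v ⁻¹) n
    wⁿ  = pow w n

  ρ∈μ⇒αA≈bᵠb : pow ρ q+1 ≈ 1# → α * A ≈ pow b q * b
  ρ∈μ⇒αA≈bᵠb ρ∈μ = trans (sym (*-identityʳ _)) (trans (*-congˡ (sym ρ∈μ)) αA*ρ^[q+1]≈bᵠb)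

  αA≈bᵠb⇒ρ∈μ : α * A ≈ pow b q * b → pow ρ q+1 ≈ 1#
  αA≈bᵠb⇒ρ∈μ e = *-cancelˡ αA≉0 (trans αA*ρ^[q+1]≈bᵠb (trans (sym e) (sym (*-identityʳ _))))
    where
    αA≉0 : α * A ≉ 0#
    αA≉0 = *-nonZero (*-nonZero (pow-nonZero q a≉0) (pow-nonZero n (⁻¹-nonZero v≉0)))
                     (*-nonZero a≉0 (pow-nonZero n (pow-nonZero q (⁻¹-nonZero v≉0))))

  E≈0⇒αA≈bᵠb : ∀ x → x ≉ 0# → E x ≈ 0# → α * A ≈ pow b q * b
  E≈0⇒αA≈bᵠb x x≉0 Ex≈0 = x-y≈0⇒x≈y (begin
    α * A - pow b q * b                        ≈⟨ solve 5 (λ α A b t bᵠ → α :* A :- bᵠ :* b := α :* (A :+ b :* t) :- b :* (α :* t :+ bᵠ)) refl α A b (τ x) (pow b q) ⟩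
    α * E x - b * (α * τ x + pow b q)          ≈⟨ +-cong (*-congˡ Ex≈0) (-‿cong (*-congˡ ατ+bᵠ≈0)) ⟩
    α * 0# - b * 0#                            ≈⟨ x≈y⇒x-y≈0 (trans (zeroʳ α) (sym (zeroʳ b))) ⟩
    0#                                         ∎)
    where
    ατ+bᵠ≈0 : α * τ x + pow b q ≈ 0#
    ατ+bᵠ≈0 = trans (sym (E*G^[q-1]≈ατ+bᵠ x x≉0)) (trans (*-congʳ Ex≈0) (zeroˡ _))

  -- Solving E*G^[q-1]≈ατ+bᵠ for τ x: the map τ x ↦ G x ^ (q - 1) is a Möbius transformation,
  -- whose determinant αA - bᵠb vanishes exactly when ρ ∈ μ.
  G^[q-1]≈⇒τ≈ : ∀ x y → x ≉ 0# → y ≉ 0# → ¬ (α * A ≈ pow b q * b) →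
                pow (G x) q-1 ≈ pow (G y) q-1 → τ x ≈ τ y
  G^[q-1]≈⇒τ≈ x y x≉0 y≉0 det≉0 Gx≈Gy = x-y≈0⇒x≈y (zero-product (begin
    (g * b - α) * (τ x - τ y)
      ≈⟨ solve 7 (λ g b α tx ty bᵠ A → (g :* b :- α) :* (tx :- ty)
                   := ((A :+ b :* tx) :* g :- (α :* tx :+ bᵠ)) :- ((A :+ b :* ty) :* g :- (α :* ty :+ bᵠ)))
                 refl g b α (τ x) (τ y) (pow b q) A ⟩
    (E x * g - (α * τ x + pow b q)) - (E y * g - (α * τ y + pow b q))
      ≈⟨ x≈y⇒x-y≈0 (trans (x≈y⇒x-y≈0 (E*G^[q-1]≈ατ+bᵠ x x≉0)) (sym (x≈y⇒x-y≈0 (trans (*-congˡ Gx≈Gy) (E*G^[q-1]≈ατ+bᵠ y y≉0))))) ⟩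
    0# ∎) gb-α≉0)
    where
    g : Carrier
    g = pow (G x) q-1
    gb-α≉0 : g * b - α ≉ 0#
    gb-α≉0 gb-α≈0 = det≉0 (x-y≈0⇒x≈y (begin
      α * A - pow b q * b
        ≈⟨ solve 6 (λ α A b t bᵠ g → α :* A :- bᵠ :* b
                     := (α :- g :* b) :* (A :+ b :* t) :+ b :* ((A :+ b :* t) :* g :- (α :* t :+ bᵠ)))
                   refl α A b (τ x) (pow b q) g ⟩
      (α - g * b) * E x + b * (E x * g - (α * τ x + pow b q))
        ≈⟨ +-cong (*-congʳ α-gb≈0) (*-congˡ EG-[ατ+bᵠ]≈0) ⟩
      0# * E x + b * 0#
        ≈⟨ trans (+-cong (zeroˡ _) (zeroʳ _)) (+-identityˡ 0#) ⟩
      0# ∎))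
      where
      α-gb≈0 : α - g * b ≈ 0#
      α-gb≈0 = x≈y⇒x-y≈0 (sym (x-y≈0⇒x≈y gb-α≈0))
      EG-[ατ+bᵠ]≈0 : E x * g - (α * τ x + pow b q) ≈ 0#
      EG-[ατ+bᵠ]≈0 = x≈y⇒x-y≈0 (E*G^[q-1]≈ατ+bᵠ x x≉0)

  σ≈⇒𝔽q-multiple : ∀ x y → y ≉ 0# → σ x ≈ σ y → ∃ λ l → pow l q-1 ≈ 1# × x ≈ l * y
  σ≈⇒𝔽q-multiple x y y≉0 σx≈σy = l , lᵠ⁻¹≈1 , s-injective (trans sx≈l*sy (sym (s-scale l y (∈𝔽q⇒frobenius-fixed lᵠ⁻¹≈1))))
    where
    sy≉0 : s y ≉ 0#
    sy≉0 = s-nonZero y≉0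
    l : Carrier
    l = s x * (s y) ⁻¹
    lᵠ⁻¹≈1 : pow l q-1 ≈ 1#
    lᵠ⁻¹≈1 = trans (pow-distrib-* _ _ q-1) (trans (*-cong σx≈σy (pow-⁻¹ (s y) q-1 sy≉0)) (⁻¹-inverse _ (pow-nonZero q-1 sy≉0)))
    sx≈l*sy : s x ≈ l * s y
    sx≈l*sy = sym (trans (*-assoc _ _ _) (trans (*-congˡ (⁻¹-inverseˡ (s y) sy≉0)) (*-identityʳ _)))

  module Sufficiency (ρ∉μ : ¬ (pow ρ q+1 ≈ 1#)) (r-coprime : gcd r q-1 ≡ 1) (n-coprime : gcd n q+1 ≡ 1) where

    αA≉bᵠb : ¬ (α * A ≈ pow b q * b)
    αA≉bᵠb e = ρ∉μ (αA≈bᵠb⇒ρ∈μ e)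

    f-nonZero : ∀ x → x ≉ 0# → f x ≉ 0#
    f-nonZero x x≉0 fx≈0 = *-nonZero (pow-nonZero r x≉0) Gx≉0
      (trans (sym (xⁿ*f≈xʳ*G x)) (trans (*-congˡ fx≈0) (zeroʳ _)))
      where
      Gx≉0 : G x ≉ 0#
      Gx≉0 = *-nonZero (pow-nonZero n (s-nonZero x≉0)) (λ Ex≈0 → αA≉bᵠb (E≈0⇒αA≈bᵠb x x≉0 Ex≈0))

    f-injective-on-units : ∀ x y → x ≉ 0# → y ≉ 0# → f x ≈ f y → x ≈ y
    f-injective-on-units x y x≉0 y≉0 fx≈fy = 𝔽q-multiple⇒≈ (σ≈⇒𝔽q-multiple x y y≉0 σx≈σy)
      where
      G^[q-1]≈ : pow (G x) q-1 ≈ pow (G y) q-1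
      G^[q-1]≈ = trans (sym (f^[q-1]≈G^[q-1] x x≉0)) (trans (pow-cong q-1 fx≈fy) (f^[q-1]≈G^[q-1] y y≉0))
      σ^[q+1]≈ : pow (σ x) q+1 ≈ pow (σ y) q+1
      σ^[q+1]≈ = trans (pow-q-1-∈μ (s x) (s-nonZero x≉0)) (sym (pow-q-1-∈μ (s y) (s-nonZero y≉0)))
      σx≈σy : σ x ≈ σ y
      σx≈σy = pow-injective-coprime n q+1 n-coprime (pow-nonZero q-1 (s-nonZero y≉0))
        (G^[q-1]≈⇒τ≈ x y x≉0 y≉0 αA≉bᵠb G^[q-1]≈) σ^[q+1]≈
      𝔽q-multiple⇒≈ : (∃ λ l → pow l q-1 ≈ 1# × x ≈ l * y) → x ≈ y
      𝔽q-multiple⇒≈ (l , lᵠ⁻¹≈1 , x≈ly) = trans x≈ly (trans (*-congʳ l≈1) (*-identityˡ y))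
        where
        lʳ≈1 : pow l r ≈ 1#
        lʳ≈1 = *-cancelʳ (f-nonZero y y≉0) (begin
          pow l r * f y   ≈⟨ f-homogeneous l y lᵠ⁻¹≈1 ⟨
          f (l * y)       ≈⟨ f-cong x≈ly ⟨
          f x             ≈⟨ fx≈fy ⟩
          f y             ≈⟨ *-identityˡ _ ⟨
          1# * f y        ∎)
        l≈1 : l ≈ 1#
        l≈1 = pow-injective-coprime r q-1 r-coprime 1#≉0# (trans lʳ≈1 (sym (pow-1# r))) (trans lᵠ⁻¹≈1 (sym (pow-1# q-1)))

    f-injective : Injective _≈_ _≈_ f
    f-injective {x} {y} fx≈fy with x ≈? 0# | y ≈? 0#
    ... | yes x≈0 | yes y≈0 = trans x≈0 (sym y≈0)
    ... | yes x≈0 | no y≉0  = ⊥-elim (f-nonZero y y≉0 (trans (sym fx≈fy) (trans (f-cong x≈0) f-0#)))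
    ... | no x≉0  | yes y≈0 = ⊥-elim (f-nonZero x x≉0 (trans fx≈fy (trans (f-cong y≈0) f-0#)))
    ... | no x≉0  | no y≉0  = f-injective-on-units x y x≉0 y≉0 fx≈fy

    f-bijective : Bijective _≈_ _≈_ f
    f-bijective = f-injective , injective⇒surjective f f-cong f-injective

  module Necessity (f-injective : Injective _≈_ _≈_ f) where

    f-nonZero : ∀ x → x ≉ 0# → f x ≉ 0#
    f-nonZero x x≉0 fx≈0 = x≉0 (f-injective (trans fx≈0 (sym f-0#)))

    ζ-fixed-by-f : ∀ ζ → pow ζ q-1 ≈ 1# → pow ζ r ≈ 1# → ζ ≈ 1#
    ζ-fixed-by-f ζ ζ^[q-1]≈1 ζʳ≈1 = trans (sym (*-identityʳ ζ)) (f-injective (begin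
      f (ζ * 1#)        ≈⟨ f-homogeneous ζ 1# ζ^[q-1]≈1 ⟩
      pow ζ r * f 1#    ≈⟨ *-congʳ ζʳ≈1 ⟩
      1# * f 1#         ≈⟨ *-identityˡ _ ⟩
      f 1#              ∎))

    -- ζ = y ^ ((q² - 1) / d) is a d-th root of unity, nontrivial for a suitable y.
    no-common-divisor-r-[q-1] : ∀ d → 1 < d → d ∣ r → d ∣ q-1 → ⊥
    no-common-divisor-r-[q-1] d 1<d d∣r d∣q-1@(divides t q-1≡td) with ∃-pow≉1 (t ℕ.* q+1) d (cofactor-of-q-1 t d q-1≡td) 1<d
    ... | y , y≉0 , ζ≉1 = ζ≉1 (ζ-fixed-by-f ζ (pow-∣≈1 ζᵈ≈1 d∣q-1) (pow-∣≈1 ζᵈ≈1 d∣r))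
      where
      ζ : Carrier
      ζ = pow y (t ℕ.* q+1)
      ζᵈ≈1 : pow ζ d ≈ 1#
      ζᵈ≈1 = trans (sym (pow-* y (t ℕ.* q+1) d)) (≡.subst (λ k → pow y k ≈ 1#) (≡.sym (cofactor-of-q-1 t d q-1≡td)) (fermat y y≉0))

    r-coprime : gcd r q-1 ≡ 1
    r-coprime = coprime-if-no-common-divisor r q-1 r≢0 no-common-divisor-r-[q-1]

    f1≉0 : f 1# ≉ 0#
    f1≉0 = f-nonZero 1# 1#≉0#

    -- f c and f 1 differ by a factor in 𝔽_q^*, which is an r-th power μ ^ r of some μ ∈ 𝔽_q^*; then f μ = f c.
    same-fibre-as-1⇒∈𝔽q : ∀ c → c ≉ 0# → pow (f c) q-1 ≈ pow (f 1#) q-1 → pow c q-1 ≈ 1#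
    same-fibre-as-1⇒∈𝔽q c c≉0 fc≈f1 = root⇒∈𝔽q (∃-root-coprime r q-1 r-coprime λᵠ⁻¹≈1)
      where
      λ′ : Carrier
      λ′ = f c * (f 1#) ⁻¹
      λᵠ⁻¹≈1 : pow λ′ q-1 ≈ 1#
      λᵠ⁻¹≈1 = trans (pow-distrib-* _ _ q-1) (trans (*-cong fc≈f1 (pow-⁻¹ (f 1#) q-1 f1≉0)) (⁻¹-inverse _ (pow-nonZero q-1 f1≉0)))
      root⇒∈𝔽q : (∃ λ μ → pow μ q-1 ≈ 1# × pow μ r ≈ λ′) → pow c q-1 ≈ 1#
      root⇒∈𝔽q (μ , μᵠ⁻¹≈1 , μʳ≈λ′) = trans (pow-cong q-1 (sym μ≈c)) μᵠ⁻¹≈1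
        where
        μ≈c : μ ≈ c
        μ≈c = trans (sym (*-identityʳ μ)) (f-injective (begin
          f (μ * 1#)                  ≈⟨ f-homogeneous μ 1# μᵠ⁻¹≈1 ⟩
          pow μ r * f 1#              ≈⟨ *-congʳ μʳ≈λ′ ⟩
          (f c * (f 1#) ⁻¹) * f 1#    ≈⟨ *-assoc _ _ _ ⟩
          f c * ((f 1#) ⁻¹ * f 1#)    ≈⟨ *-congˡ (⁻¹-inverseˡ _ f1≉0) ⟩
          f c * 1#                    ≈⟨ *-identityʳ _ ⟩
          f c                         ∎))

    -- If ρ ∈ μ then G ^ (q - 1), hence f ^ (q - 1), is constant on 𝔽_{q²}^*.
    ρ∉μ : ¬ (pow ρ q+1 ≈ 1#)
    ρ∉μ ρ∈μ = no-t (∃-pow≉1 q-1 q+1 (≡.sym q²-1≡[q-1][q+1]) (s≤s (ℕP.<-trans (s≤s z≤n) q≥2)))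
      where
      αA≈bᵠb : α * A ≈ pow b q * b
      αA≈bᵠb = ρ∈μ⇒αA≈bᵠb ρ∈μ
      κ : Carrier
      κ = α * b ⁻¹
      E-nonZero : ∀ x → x ≉ 0# → E x ≉ 0#
      E-nonZero x x≉0 Ex≈0 = f-nonZero x x≉0 (zero-product xⁿf≈0 (pow-nonZero n x≉0))
        where
        xⁿf≈0 : pow x n * f x ≈ 0#
        xⁿf≈0 = trans (xⁿ*f≈xʳ*G x) (trans (*-congˡ (trans (*-congˡ Ex≈0) (zeroʳ _))) (zeroʳ _))
      G^[q-1]≈κ : ∀ x → x ≉ 0# → pow (G x) q-1 ≈ κ
      G^[q-1]≈κ x x≉0 = *-cancelˡ (E-nonZero x x≉0) (begin
        E x * pow (G x) q-1                         ≈⟨ E*G^[q-1]≈ατ+bᵠ x x≉0 ⟩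
        α * τ x + pow b q                           ≈⟨ trans (*-congˡ (⁻¹-inverse b b≉0)) (*-identityʳ _) ⟨
        (α * τ x + pow b q) * (b * b ⁻¹)            ≈⟨ solve 5 (λ α t bᵠ b b⁻¹ → (α :* t :+ bᵠ) :* (b :* b⁻¹) := (bᵠ :* b) :* b⁻¹ :+ (α :* t) :* (b :* b⁻¹)) refl α (τ x) (pow b q) b (b ⁻¹) ⟩
        (pow b q * b) * b ⁻¹ + (α * τ x) * (b * b ⁻¹) ≈⟨ +-congʳ (*-congʳ αA≈bᵠb) ⟨
        (α * A) * b ⁻¹ + (α * τ x) * (b * b ⁻¹)     ≈⟨ solve 5 (λ α A t b b⁻¹ → (α :* A) :* b⁻¹ :+ (α :* t) :* (b :* b⁻¹) := (A :+ b :* t) :* (α :* b⁻¹)) refl α A (τ x) b (b ⁻¹) ⟩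
        E x * κ                                     ∎)
      no-t : ¬ (∃ λ t → t ≉ 0# × pow t q-1 ≉ 1#)
      no-t (t , t≉0 , tᵠ⁻¹≉1) = tᵠ⁻¹≉1 (same-fibre-as-1⇒∈𝔽q t t≉0 ft≈f1)
        where
        ft≈f1 : pow (f t) q-1 ≈ pow (f 1#) q-1
        ft≈f1 = trans (f^[q-1]≈G^[q-1] t t≉0) (trans (G^[q-1]≈κ t t≉0)
                  (sym (trans (f^[q-1]≈G^[q-1] 1# 1#≉0#) (G^[q-1]≈κ 1# 1#≉0#))))

    -- An η ∉ 𝔽_q with (η ^ (q - 1)) ^ n = 1 gives γ = s⁻¹ (η s 1) ∉ 𝔽_q in the fibre of 1.
    no-common-divisor-n-[q+1] : ∀ d → 1 < d → d ∣ n → d ∣ q+1 → ⊥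
    no-common-divisor-n-[q+1] d 1<d d∣n (divides e q+1≡ed) = no-y (∃-pow≉1 (q-1 ℕ.* e) d (cofactor-of-q+1 e d q+1≡ed) 1<d)
      where
      no-y : ¬ (∃ λ y → y ≉ 0# × pow y (q-1 ℕ.* e) ≉ 1#)
      no-y (y , y≉0 , yᵐ≉1) = θ≉1 θ≈1
        where
        η θ γ : Carrier
        η = pow y e
        θ = pow η q-1
        γ = s⁻¹ (η * s 1#)
        θ≉1 : θ ≉ 1#
        θ≉1 θ≈1 = yᵐ≉1 (trans (pow-*ʳ y q-1 e) θ≈1)
        θᵈ≈1 : pow θ d ≈ 1#
        θᵈ≈1 = trans (sym (pow-* η q-1 d)) (trans (sym (pow-* y e (q-1 ℕ.* d)))
                 (≡.subst (λ k → pow y k ≈ 1#) (≡.sym e[[q-1]d]≡q²-1) (fermat y y≉0)))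
          where
          e[[q-1]d]≡q²-1 : e ℕ.* (q-1 ℕ.* d) ≡ q ^ 2 ∸ 1
          e[[q-1]d]≡q²-1 = ≡.trans (≡.sym (ℕP.*-assoc e q-1 d))
            (≡.trans (≡.cong (ℕ._* d) (ℕP.*-comm e q-1)) (cofactor-of-q+1 e d q+1≡ed))
        θⁿ≈1 : pow θ n ≈ 1#
        θⁿ≈1 = pow-∣≈1 θᵈ≈1 d∣n
        η≉0 : η ≉ 0#
        η≉0 = pow-nonZero e y≉0
        s1≉0 : s 1# ≉ 0#
        s1≉0 = s-nonZero 1#≉0#
        sγ≈ηs1 : s γ ≈ η * s 1#
        sγ≈ηs1 = s∘s⁻¹ (η * s 1#)
        γ≉0 : γ ≉ 0#
        γ≉0 γ≈0 = *-nonZero η≉0 s1≉0 (trans (sym sγ≈ηs1) (trans (s-cong γ≈0) s-0#))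
        τγ≈τ1 : τ γ ≈ τ 1#
        τγ≈τ1 = begin
          pow (pow (s γ) q-1) n         ≈⟨ pow-cong n (trans (pow-cong q-1 sγ≈ηs1) (pow-distrib-* η (s 1#) q-1)) ⟩
          pow (θ * σ 1#) n              ≈⟨ pow-distrib-* θ (σ 1#) n ⟩
          pow θ n * τ 1#                ≈⟨ *-congʳ θⁿ≈1 ⟩
          1# * τ 1#                     ≈⟨ *-identityˡ _ ⟩
          τ 1#                          ∎
        Gγ^[q-1]≈G1^[q-1] : pow (G γ) q-1 ≈ pow (G 1#) q-1
        Gγ^[q-1]≈G1^[q-1] = begin
          pow (pow (s γ) n * E γ) q-1                   ≈⟨ pow-cong q-1 (*-cong (trans (pow-cong n sγ≈ηs1) (pow-distrib-* η (s 1#) n)) (+-congˡ (*-congˡ τγ≈τ1))) ⟩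
          pow ((pow η n * pow (s 1#) n) * E 1#) q-1     ≈⟨ pow-cong q-1 (*-assoc _ _ _) ⟩
          pow (pow η n * G 1#) q-1                      ≈⟨ pow-distrib-* _ _ q-1 ⟩
          pow (pow η n) q-1 * pow (G 1#) q-1            ≈⟨ *-congʳ (trans (pow-pow-comm η n q-1) θⁿ≈1) ⟩
          1# * pow (G 1#) q-1                           ≈⟨ *-identityˡ _ ⟩
          pow (G 1#) q-1                                ∎
        γ∈𝔽q : pow γ q-1 ≈ 1#
        γ∈𝔽q = same-fibre-as-1⇒∈𝔽q γ γ≉0
          (trans (f^[q-1]≈G^[q-1] γ γ≉0) (trans Gγ^[q-1]≈G1^[q-1] (sym (f^[q-1]≈G^[q-1] 1# 1#≉0#))))
        η≈γ : η ≈ γ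
        η≈γ = *-cancelʳ s1≉0 (trans (sym sγ≈ηs1) (trans (s-cong (sym (*-identityʳ γ))) (s-scale γ 1# (∈𝔽q⇒frobenius-fixed γ∈𝔽q))))
        θ≈1 : θ ≈ 1#
        θ≈1 = trans (pow-cong q-1 η≈γ) γ∈𝔽q

    n-coprime : gcd n q+1 ≡ 1
    n-coprime = coprime-if-no-common-divisor n q+1 n≢0 no-common-divisor-n-[q+1]

theorem1p2 : ∀ {c ℓ} (q : ℕ) → IsPrimePower q →
  (F : Field c ℓ) → HasCardinality F (q ^ 2) →
  (r n : ℕ) → r ≢ 0 → n ≢ 0 → r % suc q ≡ n % suc q →
  (a b v : Field.Carrier F) →
  ¬ Field._≈_ F a (Field.0# F) → ¬ Field._≈_ F b (Field.0# F) → ¬ Field._≈_ F v (Field.0# F) →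
  ¬ Field._≈_ F (Field.pow F v (suc q)) (Field.1# F) →
  let open Field F
      B : Carrier → Carrier
      B X = (a * pow (X + pow (v ⁻¹) q) n) + (b * pow (X + v) n)
      f : Carrier → Carrier
      f X = pow X r * B (pow X (q ∸ 1))
  in Bijective _≈_ _≈_ f ⇔
     (¬ (pow ((b * pow v n) * (a ⁻¹)) (suc q) ≈ 1#) × gcd r (q ∸ 1) ≡ 1 × gcd n (suc q) ≡ 1)
theorem1p2 q q-primePower F card r n r≢0 n≢0 r≡n a b v a≉0 b≉0 v≉0 v∉μ = mk⇔
  (λ (f-injective , _) → let open Necessity f-injective in ρ∉μ , r-coprime , n-coprime)
  (λ (ρ∉μ , r-coprime , n-coprime) → Sufficiency.f-bijective ρ∉μ r-coprime n-coprime)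
  where open PermutationCriterion F q q-primePower card r n r≢0 n≢0 r≡n a b v a≉0 b≉0 v≉0 v∉μ
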